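{- For every integer $n \ge 1$, \[\sum_{d\mid n}\left[\varphi\!\left(\frac{n}{d}\right)\right]^2\left(\frac{n}{d}\right)^{d-1}(d-1)! \equiv 0 \pmod n,\] where the sum runs over the positive divisors $d$ of $n$ and $\varphi$ is Euler's totient function. -}

module Defs where

open import Data.Nat using (ℕ; zero; suc; _+_; _*_; _^_; _/_; _∸_)
open import Data.Nat.GCD using (gcd)
open import Data.Nat.Divisibility using (_∣_; _∣?_)
open import Data.Nat using (_!)
open import Data.List using (List; filter; map; applyUpTo; length)
open import Data.Nat.ListAction using (sum)
open import Relation.Binary.PropositionalEquality using (_≡_)
open import Data.Nat using (_≟_)

-- Euler's totient: φ m = #{ k ∈ {1,…,m} : gcd k m = 1 }.  (φ 0 = 0, irrelevant here.)
φ : ℕ → ℕ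
φ m = length (filter (λ k → gcd k m ≟ 1) (applyUpTo suc m))

divisors : ℕ → List ℕ
divisors n = filter (λ d → d ∣? n) (applyUpTo suc n)

term : ℕ → ℕ → ℕ
term n zero = 0
term n (suc e) = (φ (n / suc e)) ^ 2 * (n / suc e) ^ e * (e !)

S : ℕ → ℕ
S n = sum (map (term n) (divisors n))

-- The cyclic group ℤ/n acts on the permutations π of ℤ/n with π 0 = 0 by
-- (c · π) x = π (x + c) − π c. By Burnside's lemma, n divides the number of
-- pairs (c, π) with c · π = π. Now c fixes π iff π (x + c) = π x + π c for all x,
-- a condition that only depends on d = gcd (c, n). A permutation fixed by a
-- divisor d of n is determined by u = π d, which must satisfy gcd (u, n) = d,
-- and by its values on 0, …, d − 1, which must vanish at 0 and be pairwise
-- distinct modulo d; there are φ (n/d) (n/d)^(d−1) (d−1)! of them. Since φ (n/d)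
-- residues c have gcd (c, n) = d, the number of fixed pairs is exactly the sum
-- of the theorem.

module Submission where

open import Data.Bool using (Bool; true; false; _∧_; _∨_; not; if_then_else_)
import Data.Bool as Bool
open import Data.Bool.Properties using (∧-identityʳ; ∧-zeroʳ; ∨-zeroʳ)
open import Data.Empty using (⊥-elim)
open import Data.List using (List; []; _∷_; _++_; [_]; map; cartesianProduct; length; applyUpTo; upTo; filter)
open import Data.List.Membership.Propositional using (_∈_; _∉_; find; lose)
open import Data.List.Membership.Propositional.Properties
  using (∈-map⁺; ∈-map⁻; ∈-cartesianProduct⁺; ∈-cartesianProduct⁻; ∈-upTo⁺; ∈-upTo⁻;
         ∈-filter⁺; ∈-filter⁻; ∈-applyUpTo⁺; ∈-applyUpTo⁻)
open import Data.List.Properties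
  using (≡-dec; ∷-injective; map-cong; map-cong-local; map-++; ++-identityʳ; ++-assoc;
         length-map; length-upTo; length-applyUpTo; upTo-∷ʳ; applyUpTo-∷ʳ)
open import Data.List.Relation.Unary.All as All using (All; []; _∷_)
open import Data.List.Relation.Unary.All.Properties using (applyUpTo⁺₁) renaming (map⁺ to All-map⁺)
open import Data.List.Relation.Unary.AllPairs using ([]; _∷_)
open import Data.List.Relation.Unary.Any using (Any; here; there; any?)
open import Data.List.Relation.Unary.Unique.Propositional using (Unique)
import Data.List.Relation.Unary.Unique.Propositional.Properties as Unique
open import Data.Nat
  using (ℕ; zero; suc; _+_; _*_; _∸_; _^_; _!; _%_; _/_; _≤_; _<_; _≥_; z≤n; s≤s; z<s; s<s; _≟_;
         NonZero; ≢-nonZero; ≢-nonZero⁻¹; >-nonZero⁻¹)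
open import Data.Nat.Combinatorics.Base using (_P′_)
open import Data.Nat.Combinatorics.Specification using (nP′k≡n[n∸1P′k∸1])
open import Data.Nat.DivMod
open import Data.Nat.Divisibility using (_∣_; _∣?_; divides; ∣-refl; ∣-antisym; ∣⇒≤; m∣m*n; n∣m*n; *-cancelˡ-∣; m%n≡0⇒n∣m)
open import Data.Nat.GCD
  using (gcd; gcd-GCD; gcd[m,n]∣m; gcd[m,n]∣n; gcd[m,n]≢0; gcd-greatest; gcd-identityˡ; c*gcd[m,n]≡gcd[cm,cn]; module Bézout)
open import Data.Nat.ListAction using (sum)
open import Data.Nat.Properties
  using (suc-injective; suc-pred; +-suc; +-assoc; +-comm; +-identityʳ; *-assoc; *-comm; *-identityˡ; *-identityʳ; *-zeroʳ;
         *-cancelˡ-≡; *-cancelʳ-≡; m*n≢0; m≤n*m; m+n∸m≡n; m∸n+n≡m; ≤-refl; ≤-reflexive; ≤-trans; ≤-antisym;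
         <⇒≤; <⇒≢; <-≤-trans; *-monoˡ-<)
open import Data.Nat.Tactic.RingSolver using (solve-∀)
open import Data.Product using (_×_; _,_; proj₁; proj₂; ∃; map₁)
import Data.Product.Properties as Product
open import Data.Sum using (inj₂)
open import Function using (_∘_; case_of_)
open import Level using (0ℓ)
open import Relation.Binary.Bundles using (Setoid)
import Relation.Binary.Construct.On as On
open import Relation.Binary.Definitions using (DecidableEquality)
open import Relation.Binary.PropositionalEquality hiding ([_])
import Relation.Binary.Reasoning.Setoid as SetoidReasoning
open import Relation.Nullary using (¬_; Dec; yes; no; contradiction)
open import Relation.Nullary.Decidable using (⌊_⌋; _×-dec_)
import Relation.Unary as U

open import Defs using (φ; divisors; term; S)

private variable
  A B : Set

⌊⌋-true : {P : Set} (p? : Dec P) → P → ⌊ p? ⌋ ≡ true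
⌊⌋-true (yes _) _ = refl
⌊⌋-true (no ¬p) p = contradiction p ¬p

⌊⌋-false : {P : Set} (p? : Dec P) → ¬ P → ⌊ p? ⌋ ≡ false
⌊⌋-false (yes p) ¬p = contradiction p ¬p
⌊⌋-false (no _)  _  = refl

⌊⌋-⇔ : {P Q : Set} → (P → Q) → (Q → P) → (p? : Dec P) (q? : Dec Q) → ⌊ p? ⌋ ≡ ⌊ q? ⌋
⌊⌋-⇔ P→Q Q→P (yes p) q? = sym (⌊⌋-true q? (P→Q p))
⌊⌋-⇔ P→Q Q→P (no ¬p) q? = sym (⌊⌋-false q? (¬p ∘ Q→P))

⌊⌋-true⁻¹ : {P : Set} (p? : Dec P) → ⌊ p? ⌋ ≡ true → P
⌊⌋-true⁻¹ (yes p) _ = p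

∧-true⁻ˡ : ∀ {a b} → a ∧ b ≡ true → a ≡ true
∧-true⁻ˡ {true} _ = refl

∧-true⁻ʳ : ∀ {a b} → a ∧ b ≡ true → b ≡ true
∧-true⁻ʳ {true} b≡true = b≡true

∧-true : ∀ {a b} → a ≡ true → b ≡ true → a ∧ b ≡ true
∧-true refl refl = refl

count : (A → Bool) → List A → ℕ
count p []       = 0
count p (x ∷ xs) = if p x then suc (count p xs) else count p xs

count-++ : (p : A → Bool) (xs ys : List A) → count p (xs ++ ys) ≡ count p xs + count p ys
count-++ p []       ys = refl
count-++ p (x ∷ xs) ys with p x
... | true  = cong suc (count-++ p xs ys)
... | false = count-++ p xs ys

count-map : (p : B → Bool) (f : A → B) (xs : List A) → count p (map f xs) ≡ count (λ x → p (f x)) xs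
count-map p f []       = refl
count-map p f (x ∷ xs) with p (f x)
... | true  = cong suc (count-map p f xs)
... | false = count-map p f xs

count-cong : (p q : A → Bool) (xs : List A) → (∀ {x} → x ∈ xs → p x ≡ q x) → count p xs ≡ count q xs
count-cong p q []       p≗q = refl
count-cong p q (x ∷ xs) p≗q with p x | q x | p≗q (here refl)
... | true  | true  | _ = cong suc (count-cong p q xs (p≗q ∘ there))
... | false | false | _ = count-cong p q xs (p≗q ∘ there)

count-cartesianProduct : (p : A × B → Bool) (xs : List A) (ys : List B) →
  count p (cartesianProduct xs ys) ≡ sum (map (λ x → count (λ y → p (x , y)) ys) xs)
count-cartesianProduct p []       ys = refl
count-cartesianProduct p (x ∷ xs) ys = trans (count-++ p (map (x ,_) ys) _)
  (cong₂ _+_ (count-map p (x ,_) ys) (count-cartesianProduct p xs ys))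

count-none : (p : A → Bool) (xs : List A) → (∀ {x} → x ∈ xs → p x ≡ false) → count p xs ≡ 0
count-none p []       none = refl
count-none p (x ∷ xs) none rewrite none (here refl) = count-none p xs (none ∘ there)

count-complement : (p : A → Bool) (xs : List A) → count p xs + count (not ∘ p) xs ≡ length xs
count-complement p []       = refl
count-complement p (x ∷ xs) with p x
... | true  = cong suc (count-complement p xs)
... | false = trans (+-suc _ _) (cong suc (count-complement p xs))

count-∨ : (p q : A → Bool) (xs : List A) → (∀ {x} → x ∈ xs → p x ∧ q x ≡ false) →
          count (λ x → p x ∨ q x) xs ≡ count p xs + count q xs
count-∨ p q []       disjoint = refl
count-∨ p q (x ∷ xs) disjoint with p x | q x | disjoint (here refl)
... | true  | false | _ = cong suc (count-∨ p q xs (disjoint ∘ there))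
... | false | true  | _ = trans (cong suc (count-∨ p q xs (disjoint ∘ there))) (sym (+-suc _ _))
... | false | false | _ = count-∨ p q xs (disjoint ∘ there)

MapsInto : (A → Bool) → List A → (B → Bool) → List B → (A → B) → Set
MapsInto p xs q ys f = ∀ {x} → x ∈ xs → p x ≡ true → f x ∈ ys × q (f x) ≡ true

LeftInverseOn : (A → Bool) → List A → (A → B) → (B → A) → Set
LeftInverseOn p xs f g = ∀ {x} → x ∈ xs → p x ≡ true → g (f x) ≡ x

module _ (_≟B_ : DecidableEquality B) where

  count-remove : (q : B → Bool) {ys : List B} {y : B} → Unique ys → y ∈ ys → q y ≡ true →
                 suc (count (λ z → q z ∧ not (⌊ z ≟B y ⌋)) ys) ≡ count q ys
  count-remove q {z ∷ ys} (z∉ys ∷ _) (here refl) qz rewrite qz | ⌊⌋-true (z ≟B z) refl =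
    cong suc (count-cong _ q ys keep)
    where
    keep : ∀ {w} → w ∈ ys → q w ∧ not (⌊ w ≟B z ⌋) ≡ q w
    keep {w} w∈ys with w ≟B z
    ... | yes refl = ⊥-elim (All.lookup z∉ys w∈ys refl)
    ... | no _     = ∧-identityʳ (q w)
  count-remove q {z ∷ ys} {y} (z∉ys ∷ u) (there y∈ys) qy with z ≟B y
  ... | yes refl = ⊥-elim (All.lookup z∉ys y∈ys refl)
  ... | no _ rewrite ∧-identityʳ (q z) with q z
  ...   | true  = cong suc (count-remove q u y∈ys qy)
  ...   | false = count-remove q u y∈ys qy

  count-≤-retraction : (p : A → Bool) (q : B → Bool) (f : A → B) (g : B → A) {xs : List A} {ys : List B} →
    Unique xs → Unique ys → MapsInto p xs q ys f → LeftInverseOn p xs f g → count p xs ≤ count q ys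
  count-≤-retraction p q f g {[]} _ _ _ _ = z≤n
  count-≤-retraction p q f g {x ∷ xs} {ys} (x∉xs ∷ uxs) uys into inv with p x in px
  ... | false = count-≤-retraction p q f g uxs uys (into ∘ there) (inv ∘ there)
  ... | true  = ≤-trans (s≤s (count-≤-retraction p q′ f g uxs uys into′ (inv ∘ there)))
                        (≤-reflexive (count-remove q uys (proj₁ (into (here refl) px)) (proj₂ (into (here refl) px))))
    where
    q′ : B → Bool
    q′ z = q z ∧ not (⌊ z ≟B f x ⌋)
    into′ : MapsInto p xs q′ ys f
    into′ {a} a∈xs pa with f a ≟B f x
    ... | yes fa≡fx = ⊥-elim (All.lookup x∉xs a∈xs
                        (trans (sym (inv (here refl) px)) (trans (cong g (sym fa≡fx)) (inv (there a∈xs) pa))))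
    ... | no _      = proj₁ (into (there a∈xs) pa) , trans (∧-identityʳ _) (proj₂ (into (there a∈xs) pa))

count-bijection : DecidableEquality A → DecidableEquality B →
  (p : A → Bool) (q : B → Bool) (f : A → B) (g : B → A) {xs : List A} {ys : List B} →
  Unique xs → Unique ys → MapsInto p xs q ys f → MapsInto q ys p xs g →
  LeftInverseOn p xs f g → LeftInverseOn q ys g f → count p xs ≡ count q ys
count-bijection _≟A_ _≟B_ p q f g uxs uys f-into g-into g∘f f∘g = ≤-antisym
  (count-≤-retraction _≟B_ p q f g uxs uys f-into g∘f)
  (count-≤-retraction _≟A_ q p g f uys uxs g-into f∘g)

sum-if : (p : A → Bool) (c : ℕ) (F : A → ℕ) (xs : List A) → (∀ {x} → x ∈ xs → F x ≡ (if p x then c else 0)) →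
         sum (map F xs) ≡ count p xs * c
sum-if p c F []       F≡ = refl
sum-if p c F (x ∷ xs) F≡ rewrite F≡ (here refl) with p x
... | true  = cong (c +_) (sum-if p c F xs (F≡ ∘ there))
... | false = sum-if p c F xs (F≡ ∘ there)

sum-map-const : (k : ℕ) (xs : List A) → sum (map (λ _ → k) xs) ≡ length xs * k
sum-map-const k []       = refl
sum-map-const k (x ∷ xs) = cong (k +_) (sum-map-const k xs)

sum-map-zero : (F : A → ℕ) (xs : List A) → (∀ {x} → x ∈ xs → F x ≡ 0) → sum (map F xs) ≡ 0
sum-map-zero F []       _  = refl
sum-map-zero F (x ∷ xs) F≡0 rewrite F≡0 (here refl) = sum-map-zero F xs (F≡0 ∘ there)

sum-map-+ : (f g : A → ℕ) (xs : List A) → sum (map (λ x → f x + g x) xs) ≡ sum (map f xs) + sum (map g xs)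
sum-map-+ f g []       = refl
sum-map-+ f g (x ∷ xs) = trans (cong (f x + g x +_) (sum-map-+ f g xs)) (interchange (f x) (g x) _ _)
  where
  interchange : ∀ a b c d → a + b + (c + d) ≡ a + c + (b + d)
  interchange = solve-∀

sum-indicator : (F : ℕ → ℕ) {a : ℕ} {ds : List ℕ} → Unique ds → a ∈ ds →
                sum (map (λ d → if ⌊ a ≟ d ⌋ then F d else 0) ds) ≡ F a
sum-indicator F {a} {d ∷ ds} (d∉ds ∷ _) (here refl) rewrite ⌊⌋-true (a ≟ a) refl =
  trans (cong (F a +_) (sum-map-zero _ ds zero-off)) (+-identityʳ (F a))
  where
  zero-off : ∀ {e} → e ∈ ds → (if ⌊ a ≟ e ⌋ then F e else 0) ≡ 0
  zero-off {e} e∈ds rewrite ⌊⌋-false (a ≟ e) (λ { refl → All.lookup d∉ds e∈ds refl }) = refl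
sum-indicator F {a} {d ∷ ds} (d∉ds ∷ uds) (there a∈ds)
  rewrite ⌊⌋-false (a ≟ d) (λ { refl → All.lookup d∉ds a∈ds refl }) = sum-indicator F uds a∈ds

fibreSize : (A → ℕ) → List A → ℕ → ℕ
fibreSize h xs d = count (λ x → ⌊ h x ≟ d ⌋) xs

sum-by-fibres : (F : ℕ → ℕ) (h : A → ℕ) (xs : List A) {ds : List ℕ} → Unique ds → (∀ {x} → x ∈ xs → h x ∈ ds) →
  sum (map (λ x → F (h x)) xs) ≡ sum (map (λ d → fibreSize h xs d * F d) ds)
sum-by-fibres F h []       {ds} _   _  = sym (sum-map-zero _ ds (λ _ → refl))
sum-by-fibres F h (x ∷ xs) {ds} uds h∈ = begin
  F (h x) + sum (map (λ y → F (h y)) xs)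
    ≡⟨ cong₂ _+_ (sym (sum-indicator F uds (h∈ (here refl)))) (sum-by-fibres F h xs uds (h∈ ∘ there)) ⟩
  sum (map (λ d → if ⌊ h x ≟ d ⌋ then F d else 0) ds) + sum (map (λ d → fibreSize h xs d * F d) ds)
    ≡⟨ sym (sum-map-+ _ _ ds) ⟩
  sum (map (λ d → (if ⌊ h x ≟ d ⌋ then F d else 0) + fibreSize h xs d * F d) ds)
    ≡⟨ cong sum (map-cong split ds) ⟩
  sum (map (λ d → fibreSize h (x ∷ xs) d * F d) ds) ∎
  where
  open ≡-Reasoning
  split : ∀ d → (if ⌊ h x ≟ d ⌋ then F d else 0) + fibreSize h xs d * F d ≡ fibreSize h (x ∷ xs) d * F d
  split d with ⌊ h x ≟ d ⌋
  ... | true  = refl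
  ... | false = refl

nth : List ℕ → ℕ → ℕ
nth []       _       = 0
nth (x ∷ xs) zero    = x
nth (x ∷ xs) (suc i) = nth xs i

nth-applyUpTo : (f : ℕ → ℕ) {k i : ℕ} → i < k → nth (applyUpTo f k) i ≡ f i
nth-applyUpTo f {suc k} {zero}  _         = refl
nth-applyUpTo f {suc k} {suc i} (s≤s i<k) = nth-applyUpTo (f ∘ suc) i<k

nth-map : (f : ℕ → ℕ) {xs : List ℕ} {i : ℕ} → i < length xs → nth (map f xs) i ≡ f (nth xs i)
nth-map f {x ∷ xs} {zero}  _         = refl
nth-map f {x ∷ xs} {suc i} (s≤s i<k) = nth-map f {xs} i<k

nth-ext : {k : ℕ} {xs ys : List ℕ} → length xs ≡ k → length ys ≡ k →
          (∀ {i} → i < k → nth xs i ≡ nth ys i) → xs ≡ ys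
nth-ext {xs = []}     {[]}     _    _    _  = refl
nth-ext {xs = []}     {_ ∷ _}  refl ()   _
nth-ext {xs = x ∷ xs} {y ∷ ys} refl |ys| eq =
  cong₂ _∷_ (eq z<s) (nth-ext refl (suc-injective |ys|) (eq ∘ s<s))

nth-< : {N : ℕ} {xs : List ℕ} → 0 < N → All (_< N) xs → ∀ i → nth xs i < N
nth-< 0<N []         _       = 0<N
nth-< 0<N (x<N ∷ _)  zero    = x<N
nth-< 0<N (_ ∷ xs<N) (suc i) = nth-< 0<N xs<N i

nth-∈ : {xs : List ℕ} {i : ℕ} → i < length xs → nth xs i ∈ xs
nth-∈ {x ∷ xs} {zero}  _         = here refl
nth-∈ {x ∷ xs} {suc i} (s≤s i<k) = there (nth-∈ i<k)

∈⇒nth : {x : ℕ} {xs : List ℕ} → x ∈ xs → ∃ λ i → i < length xs × nth xs i ≡ x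
∈⇒nth (here refl) = 0 , z<s , refl
∈⇒nth (there x∈xs) with i , i<k , eq ← ∈⇒nth x∈xs = suc i , s<s i<k , eq

infix 6.5 _∈ᵇ_
_∈ᵇ_ : ℕ → List ℕ → Bool
x ∈ᵇ []       = false
x ∈ᵇ (y ∷ ys) = ⌊ x ≟ y ⌋ ∨ x ∈ᵇ ys

∈ᵇ⇒∈ : {x : ℕ} (ys : List ℕ) → x ∈ᵇ ys ≡ true → x ∈ ys
∈ᵇ⇒∈ {x} (y ∷ ys) x∈ᵇ with x ≟ y
... | yes refl = here refl
... | no _     = there (∈ᵇ⇒∈ ys x∈ᵇ)

∈⇒∈ᵇ : {x : ℕ} {ys : List ℕ} → x ∈ ys → x ∈ᵇ ys ≡ true
∈⇒∈ᵇ {x} (here refl) rewrite ⌊⌋-true (x ≟ x) refl = refl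
∈⇒∈ᵇ {x} {y ∷ ys} (there x∈ys) rewrite ∈⇒∈ᵇ x∈ys = ∨-zeroʳ (⌊ x ≟ y ⌋)

∉⇒∈ᵇ-false : {x : ℕ} (ys : List ℕ) → x ∉ ys → x ∈ᵇ ys ≡ false
∉⇒∈ᵇ-false {x} ys x∉ys with x ∈ᵇ ys in x∈ᵇ
... | true  = ⊥-elim (x∉ys (∈ᵇ⇒∈ ys x∈ᵇ))
... | false = refl

distinct : List ℕ → Bool
distinct []       = true
distinct (x ∷ xs) = not (x ∈ᵇ xs) ∧ distinct xs

head-∉ : (x : ℕ) (xs : List ℕ) → distinct (x ∷ xs) ≡ true → x ∉ xs
head-∉ x xs d x∈xs with x ∈ᵇ xs | ∈⇒∈ᵇ x∈xs
head-∉ x xs () x∈xs | true | refl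

NthInjective : List ℕ → Set
NthInjective xs = ∀ {i j} → i < length xs → j < length xs → nth xs i ≡ nth xs j → i ≡ j

distinct⇒nth-injective : (xs : List ℕ) → distinct xs ≡ true → NthInjective xs
distinct⇒nth-injective (x ∷ xs) d {zero}  {zero}  _ _ _ = refl
distinct⇒nth-injective (x ∷ xs) d {zero}  {suc j} _ (s≤s j<k) x≡ =
  contradiction (subst (_∈ xs) (sym x≡) (nth-∈ j<k)) (head-∉ x xs d)
distinct⇒nth-injective (x ∷ xs) d {suc i} {zero}  (s≤s i<k) _ ≡x =
  contradiction (subst (_∈ xs) ≡x (nth-∈ i<k)) (head-∉ x xs d)
distinct⇒nth-injective (x ∷ xs) d {suc i} {suc j} (s≤s i<k) (s≤s j<k) eq =
  cong suc (distinct⇒nth-injective xs (∧-true⁻ʳ {not (x ∈ᵇ xs)} d) i<k j<k eq)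

nth-injective⇒distinct : (xs : List ℕ) → NthInjective xs → distinct xs ≡ true
nth-injective⇒distinct []       _   = refl
nth-injective⇒distinct (x ∷ xs) inj with x ∈ᵇ xs in x∈ᵇ
... | false = nth-injective⇒distinct xs (λ i<k j<k eq → suc-injective (inj (s<s i<k) (s<s j<k) eq))
... | true with i , i<k , eq ← ∈⇒nth (∈ᵇ⇒∈ xs x∈ᵇ) = case inj z<s (s<s i<k) (sym eq) of λ ()

distinct-swap : ∀ a b L → distinct (a ∷ b ∷ L) ≡ not (b ∈ᵇ (a ∷ L)) ∧ distinct (a ∷ L)
distinct-swap a b L rewrite ⌊⌋-⇔ sym sym (a ≟ b) (b ≟ a) = interchange ⌊ b ≟ a ⌋ (a ∈ᵇ L) (b ∈ᵇ L) (distinct L)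
  where
  interchange : ∀ p x y d → not (p ∨ x) ∧ (not y ∧ d) ≡ not (p ∨ y) ∧ (not x ∧ d)
  interchange true  _     _     _ = refl
  interchange false true  true  _ = refl
  interchange false true  false _ = refl
  interchange false false true  _ = refl
  interchange false false false _ = refl

count-≟ : {x : ℕ} {xs : List ℕ} → Unique xs → x ∈ xs → count (λ y → ⌊ y ≟ x ⌋) xs ≡ 1
count-≟ {x} {x ∷ xs} (x∉xs ∷ _) (here refl) rewrite ⌊⌋-true (x ≟ x) refl =
  cong suc (count-none _ xs λ {y} y∈xs → ⌊⌋-false (y ≟ x) λ { refl → All.lookup x∉xs y∈xs refl })
count-≟ {x} {y ∷ xs} (y∉xs ∷ uxs) (there x∈xs)
  rewrite ⌊⌋-false (y ≟ x) (λ { refl → All.lookup y∉xs x∈xs refl }) = count-≟ uxs x∈xs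

count-∈ᵇ : ∀ N {L} → distinct L ≡ true → All (_< N) L → count (_∈ᵇ L) (upTo N) ≡ length L
count-∈ᵇ N {[]}    _ _ = count-none _ (upTo N) (λ _ → refl)
count-∈ᵇ N {x ∷ L} d (x<N ∷ L<N) = trans (count-∨ _ _ (upTo N) disjoint)
  (cong₂ _+_ (count-≟ (Unique.upTo⁺ N) (∈-upTo⁺ x<N)) (count-∈ᵇ N (∧-true⁻ʳ {not (x ∈ᵇ L)} d) L<N))
  where
  disjoint : ∀ {r} → r ∈ upTo N → ⌊ r ≟ x ⌋ ∧ r ∈ᵇ L ≡ false
  disjoint {r} _ with r ≟ x
  ... | yes refl = ∉⇒∈ᵇ-false L (head-∉ x L d)
  ... | no _     = refl

count-∉ᵇ : ∀ N {L} → distinct L ≡ true → All (_< N) L → count (λ r → not (r ∈ᵇ L)) (upTo N) ≡ N ∸ length L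
count-∉ᵇ N {L} d L<N = begin
  count (λ r → not (r ∈ᵇ L)) (upTo N)                                   ≡⟨ m+n∸m≡n (count (_∈ᵇ L) (upTo N)) _ ⟨
  count (_∈ᵇ L) (upTo N) + count (λ r → not (r ∈ᵇ L)) (upTo N) ∸ count (_∈ᵇ L) (upTo N)
    ≡⟨ cong₂ _∸_ (trans (count-complement (_∈ᵇ L) (upTo N)) (length-upTo N)) (count-∈ᵇ N d L<N) ⟩
  N ∸ length L                                                          ∎
  where open ≡-Reasoning

upTo-+ : ∀ a b → upTo (a + b) ≡ upTo a ++ map (a +_) (upTo b)
upTo-+ a zero    = trans (cong upTo (+-identityʳ a)) (sym (++-identityʳ (upTo a)))
upTo-+ a (suc b) = begin
  upTo (a + suc b)                              ≡⟨ cong upTo (+-suc a b) ⟩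
  upTo (suc (a + b))                            ≡⟨ upTo-∷ʳ (a + b) ⟨
  upTo (a + b) ++ [ a + b ]                     ≡⟨ cong (_++ [ a + b ]) (upTo-+ a b) ⟩
  (upTo a ++ map (a +_) (upTo b)) ++ [ a + b ]  ≡⟨ ++-assoc (upTo a) _ _ ⟩
  upTo a ++ (map (a +_) (upTo b) ++ [ a + b ])  ≡⟨ cong (upTo a ++_) (map-++ (a +_) (upTo b) [ b ]) ⟨
  upTo a ++ map (a +_) (upTo b ++ [ b ])        ≡⟨ cong (λ bs → upTo a ++ map (a +_) bs) (upTo-∷ʳ b) ⟩
  upTo a ++ map (a +_) (upTo (suc b))           ∎
  where open ≡-Reasoning

count-residues : ∀ g .{{_ : NonZero g}} (p : ℕ → Bool) k → count (λ x → p (x % g)) (upTo (k * g)) ≡ k * count p (upTo g)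
count-residues g p zero    = refl
count-residues g p (suc k) = begin
  count (λ x → p (x % g)) (upTo (g + k * g))
    ≡⟨ cong (count _) (upTo-+ g (k * g)) ⟩
  count (λ x → p (x % g)) (upTo g ++ map (g +_) (upTo (k * g)))
    ≡⟨ count-++ _ (upTo g) _ ⟩
  count (λ x → p (x % g)) (upTo g) + count (λ x → p (x % g)) (map (g +_) (upTo (k * g)))
    ≡⟨ cong₂ _+_ (count-cong _ p (upTo g) λ r∈ → cong p (m<n⇒m%n≡m (∈-upTo⁻ r∈)))
                 (count-map _ (g +_) (upTo (k * g))) ⟩
  count p (upTo g) + count (λ x → p ((g + x) % g)) (upTo (k * g))
    ≡⟨ cong (count p (upTo g) +_) (count-cong _ _ (upTo (k * g)) λ {x} _ →
         cong p (trans (cong (_% g) (+-comm g x)) ([m+n]%n≡m%n x g))) ⟩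
  count p (upTo g) + count (λ x → p (x % g)) (upTo (k * g))
    ≡⟨ cong (count p (upTo g) +_) (count-residues g p k) ⟩
  count p (upTo g) + k * count p (upTo g)       ∎
  where open ≡-Reasoning

tuples : ℕ → ℕ → List (List ℕ)
tuples N zero    = [] ∷ []
tuples N (suc k) = map (λ (v , x) → x ∷ v) (cartesianProduct (tuples N k) (upTo N))

count-tuples : (p : List ℕ → Bool) (N k : ℕ) →
  count p (tuples N (suc k)) ≡ sum (map (λ v → count (λ x → p (x ∷ v)) (upTo N)) (tuples N k))
count-tuples p N k = trans (count-map p _ (cartesianProduct (tuples N k) (upTo N)))
                           (count-cartesianProduct _ (tuples N k) (upTo N))

tuples-unique : (N k : ℕ) → Unique (tuples N k)
tuples-unique N zero    = [] ∷ []
tuples-unique N (suc k) = Unique.map⁺ cons-injective (Unique.cartesianProduct⁺ (tuples-unique N k) (Unique.upTo⁺ N))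
  where
  cons-injective : ∀ {p q : List ℕ × ℕ} → proj₂ p ∷ proj₁ p ≡ proj₂ q ∷ proj₁ q → p ≡ q
  cons-injective {v , x} {w , y} eq with refl , refl ← ∷-injective eq = refl

∈-tuples⁻ : {N k : ℕ} {v : List ℕ} → v ∈ tuples N k → length v ≡ k × All (_< N) v
∈-tuples⁻ {k = zero}  (here refl) = refl , []
∈-tuples⁻ {k = suc k} v∈ with (w , x) , wx∈ , refl ← ∈-map⁻ _ v∈ with w∈ , x∈ ← ∈-cartesianProduct⁻ _ _ wx∈ =
  cong suc (proj₁ (∈-tuples⁻ {k = k} w∈)) , ∈-upTo⁻ x∈ ∷ proj₂ (∈-tuples⁻ {k = k} w∈)

∈-tuples⁺ : {N k : ℕ} {v : List ℕ} → length v ≡ k → All (_< N) v → v ∈ tuples N k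
∈-tuples⁺ {v = []}    refl []          = here refl
∈-tuples⁺ {v = x ∷ v} refl (x<N ∷ v<N) =
  ∈-map⁺ (λ (v , x) → x ∷ v) (∈-cartesianProduct⁺ (∈-tuples⁺ refl v<N) (∈-upTo⁺ x<N))

-- Arithmetic modulo M

module Modulo (M : ℕ) .{{_ : NonZero M}} where

  infix 4 _≈_
  _≈_ : ℕ → ℕ → Set
  a ≈ b = a % M ≡ b % M

  ≈-setoid : Setoid 0ℓ 0ℓ
  ≈-setoid = On.setoid {B = ℕ} (setoid ℕ) (_% M)

  module ≈-Reasoning = SetoidReasoning ≈-setoid

  0<M : 0 < M
  0<M = >-nonZero⁻¹ M

  ≡⇒≈ : ∀ {a b} → a ≡ b → a ≈ b
  ≡⇒≈ = cong (_% M)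

  ≈-+ : ∀ {a b c d} → a ≈ b → c ≈ d → a + c ≈ b + d
  ≈-+ {a} {b} {c} {d} a≈b c≈d = begin
    (a + c) % M             ≡⟨ %-distribˡ-+ a c M ⟩
    (a % M + c % M) % M     ≡⟨ cong₂ (λ x y → (x + y) % M) a≈b c≈d ⟩
    (b % M + d % M) % M     ≡⟨ %-distribˡ-+ b d M ⟨
    (b + d) % M             ∎
    where open ≡-Reasoning

  ≈-* : ∀ {a b c d} → a ≈ b → c ≈ d → a * c ≈ b * d
  ≈-* {a} {b} {c} {d} a≈b c≈d = begin
    (a * c) % M             ≡⟨ %-distribˡ-* a c M ⟩
    (a % M * (c % M)) % M   ≡⟨ cong₂ (λ x y → (x * y) % M) a≈b c≈d ⟩
    (b % M * (d % M)) % M   ≡⟨ %-distribˡ-* b d M ⟨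
    (b * d) % M             ∎
    where open ≡-Reasoning

  %-≈ : ∀ a → a % M ≈ a
  %-≈ a = m%n%n≡m%n a M

  +-multiple-≈ : ∀ a k → a + k * M ≈ a
  +-multiple-≈ a k = [m+kn]%n≡m%n a k M

  M≈0 : M ≈ 0
  M≈0 = trans (n%n≡0 M) (sym (m<n⇒m%n≡m 0<M))

  multiple-≈0 : ∀ k → k * M ≈ 0
  multiple-≈0 k = trans (m*n%n≡0 k M) (sym (m<n⇒m%n≡m 0<M))

  ≈⇒≡ : ∀ {a b} → a < M → b < M → a ≈ b → a ≡ b
  ≈⇒≡ a<M b<M a≈b = trans (sym (m<n⇒m%n≡m a<M)) (trans a≈b (m<n⇒m%n≡m b<M))

  ≈0⇒∣ : ∀ {a} → a ≈ 0 → M ∣ a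
  ≈0⇒∣ {a} a≈0 = m%n≡0⇒n∣m a M (trans a≈0 (m<n⇒m%n≡m 0<M))

  ≈-cancelʳ-+ : ∀ {a b} c → a + c ≈ b + c → a ≈ b
  ≈-cancelʳ-+ {a} {b} c eq = begin
    a                         ≈⟨ +-multiple-≈ a c ⟨
    a + c * M                 ≡⟨ spread a ⟩
    (a + c) + c * (M ∸ 1)     ≈⟨ ≈-+ eq refl ⟩
    (b + c) + c * (M ∸ 1)     ≡⟨ spread b ⟨
    b + c * M                 ≈⟨ +-multiple-≈ b c ⟩
    b                         ∎
    where
    open ≈-Reasoning
    -- adding c copies of M turns − c into + c (M − 1), avoiding truncated subtraction
    spread : ∀ x → x + c * M ≡ (x + c) + c * (M ∸ 1)
    spread x = trans (cong (λ y → x + c * y) (sym (suc-pred M))) (expand x c (M ∸ 1))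
      where
      expand : ∀ x c k → x + c * suc k ≡ (x + c) + c * k
      expand = solve-∀

  ≈-cancelˡ-+ : ∀ {a b} c → c + a ≈ c + b → a ≈ b
  ≈-cancelˡ-+ {a} {b} c eq = ≈-cancelʳ-+ c (trans (≡⇒≈ (+-comm a c)) (trans eq (≡⇒≈ (+-comm c b))))

  infixl 6 _⊖_
  _⊖_ : ℕ → ℕ → ℕ
  a ⊖ b = (a + (M ∸ b % M)) % M

  ⊖<M : ∀ a b → a ⊖ b < M
  ⊖<M a b = m%n<n _ M

  ⊖-+ : ∀ a b → a ⊖ b + b ≈ a
  ⊖-+ a b = begin
    (a + (M ∸ b % M)) % M + b     ≈⟨ ≈-+ (%-≈ (a + (M ∸ b % M))) (sym (%-≈ b)) ⟩
    a + (M ∸ b % M) + b % M       ≡⟨ +-assoc a _ _ ⟩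
    a + ((M ∸ b % M) + b % M)     ≡⟨ cong (a +_) (m∸n+n≡m (<⇒≤ (m%n<n b M))) ⟩
    a + M                         ≡⟨ cong (a +_) (+-identityʳ M) ⟨
    a + 1 * M                     ≈⟨ +-multiple-≈ a 1 ⟩
    a                             ∎
    where open ≈-Reasoning

  ⊖-unique : ∀ {a b z} → z < M → z + b ≈ a → z ≡ a ⊖ b
  ⊖-unique {a} {b} z<M z+b≈a = ≈⇒≡ z<M (⊖<M a b) (≈-cancelʳ-+ b (trans z+b≈a (sym (⊖-+ a b))))

  ≈-⊖ : ∀ {a b c} → a ≈ b + c → a ⊖ c ≡ b % M
  ≈-⊖ {a} {b} {c} a≈b+c = sym (⊖-unique (m%n<n b M) (trans (≈-+ (%-≈ b) refl) (sym a≈b+c)))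

  ⊖-self : ∀ a → a ⊖ a ≡ 0
  ⊖-self a = sym (⊖-unique 0<M refl)

  ⊖-identityʳ : ∀ {a} → a < M → a ⊖ 0 ≡ a
  ⊖-identityʳ {a} a<M = sym (⊖-unique a<M (≡⇒≈ (+-identityʳ a)))

  ⊖-⊖ : ∀ a b c → (a ⊖ c) ⊖ (b ⊖ c) ≡ a ⊖ b
  ⊖-⊖ a b c = ⊖-unique (⊖<M _ _) (begin
    (a ⊖ c) ⊖ (b ⊖ c) + b               ≈⟨ ≈-+ {(a ⊖ c) ⊖ (b ⊖ c)} refl (⊖-+ b c) ⟨
    (a ⊖ c) ⊖ (b ⊖ c) + (b ⊖ c + c)     ≡⟨ +-assoc _ (b ⊖ c) c ⟨
    (a ⊖ c) ⊖ (b ⊖ c) + (b ⊖ c) + c     ≈⟨ ≈-+ (⊖-+ (a ⊖ c) (b ⊖ c)) refl ⟩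
    a ⊖ c + c                           ≈⟨ ⊖-+ a c ⟩
    a                                   ∎)
    where open ≈-Reasoning

  ⊖-injectiveˡ : ∀ {a b} c → a ⊖ c ≡ b ⊖ c → a ≈ b
  ⊖-injectiveˡ {a} {b} c eq = trans (sym (⊖-+ a c)) (trans (≈-+ (≡⇒≈ eq) refl) (⊖-+ b c))

  ≈⇒%-divisor : ∀ {d a b} .{{_ : NonZero d}} → d ∣ M → a ≈ b → a % d ≡ b % d
  ≈⇒%-divisor {d} {a} {b} d∣M a≈b =
    trans (sym (m∣n⇒o%n%m≡o%m d M a d∣M)) (trans (cong (_% d) a≈b) (m∣n⇒o%n%m≡o%m d M b d∣M))

  bézout-inverse : ∀ a → ∃ λ k → k * a ≈ gcd a M
  bézout-inverse a with Bézout.identity (gcd-GCD a M)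
  ... | Bézout.+- x y eq = x , trans (≡⇒≈ (sym eq)) (+-multiple-≈ (gcd a M) y)
  -- here x a ≡ − gcd a M, and − x ≡ (M − 1) x
  ... | Bézout.-+ x y eq = (M ∸ 1) * x , ≈-cancelʳ-+ (x * a) (begin
    (M ∸ 1) * x * a + x * a     ≡⟨ lemma ⟨
    x * a * M                   ≈⟨ multiple-≈0 (x * a) ⟩
    0                           ≈⟨ multiple-≈0 y ⟨
    y * M                       ≡⟨ eq ⟨
    gcd a M + x * a             ∎)
    where
    open ≈-Reasoning
    expand : ∀ x a k → x * a * suc k ≡ k * x * a + x * a
    expand = solve-∀
    lemma : x * a * M ≡ (M ∸ 1) * x * a + x * a
    lemma = trans (cong (x * a *_) (sym (suc-pred M))) (expand x a (M ∸ 1))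

  ≈-cancelʳ-* : ∀ {a b c} → gcd c M ≡ 1 → a * c ≈ b * c → a ≈ b
  ≈-cancelʳ-* {a} {b} {c} coprime ac≈bc = begin
    a                 ≡⟨ *-identityʳ a ⟨
    a * 1             ≈⟨ ≈-* {a} refl k*c≈1 ⟨
    a * (k * c)       ≡⟨ swap a k c ⟩
    a * c * k         ≈⟨ ≈-* ac≈bc refl ⟩
    b * c * k         ≡⟨ swap b k c ⟨
    b * (k * c)       ≈⟨ ≈-* {b} refl k*c≈1 ⟩
    b * 1             ≡⟨ *-identityʳ b ⟩
    b                 ∎
    where
    open ≈-Reasoning
    k = proj₁ (bézout-inverse c)
    k*c≈1 : k * c ≈ 1
    k*c≈1 = trans (proj₂ (bézout-inverse c)) (cong (_% M) coprime)
    swap : ∀ a k c → a * (k * c) ≡ a * c * k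
    swap = solve-∀

-- Burnside's lemma for a cyclic action

first : (A → Bool) → List A → A → A
first p []       d = d
first p (x ∷ xs) d = if p x then x else first p xs d

first-cong : (p q : A → Bool) (xs : List A) (d : A) → (∀ z → p z ≡ q z) → first p xs d ≡ first q xs d
first-cong p q []       d p≗q = refl
first-cong p q (x ∷ xs) d p≗q rewrite p≗q x with q x
... | true  = refl
... | false = first-cong p q xs d p≗q

first-satisfies : (p : A → Bool) {xs : List A} (d : A) {z : A} → z ∈ xs → p z ≡ true →
                  first p xs d ∈ xs × p (first p xs d) ≡ true
first-satisfies p {x ∷ xs} d z∈ pz with p x in px
... | true = here refl , px
first-satisfies p {x ∷ xs} d (here refl) pz | false = case trans (sym pz) px of λ ()
first-satisfies p {x ∷ xs} d (there z∈) pz | false =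
  map₁ there (first-satisfies p d z∈ pz)

first-default : (p : A → Bool) {xs : List A} (d d′ : A) {z : A} → z ∈ xs → p z ≡ true → first p xs d ≡ first p xs d′
first-default p {x ∷ xs} d d′ z∈ pz with p x in px
... | true = refl
first-default p {x ∷ xs} d d′ (here refl) pz | false = case trans (sym pz) px of λ ()
first-default p {x ∷ xs} d d′ (there z∈) pz | false = first-default p d d′ z∈ pz

module CyclicBurnside {X : Set} (_≟X_ : DecidableEquality X) (n : ℕ) .{{_ : NonZero n}}
  (act : ℕ → X → X) {ys : List X} (ys-unique : Unique ys)
  (act-closed : ∀ c {x} → x ∈ ys → act c x ∈ ys)
  (act-+ : ∀ a b {x} → x ∈ ys → act (a + b) x ≡ act a (act b x))
  (act-n : ∀ {x} → x ∈ ys → act n x ≡ x)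
  where

  open Modulo n

  act-zero : ∀ {x} → x ∈ ys → act 0 x ≡ x
  act-zero {x} x∈ = begin
    act 0 x         ≡⟨ cong (act 0) (act-n x∈) ⟨
    act 0 (act n x) ≡⟨ act-+ 0 n x∈ ⟨
    act n x         ≡⟨ act-n x∈ ⟩
    x               ∎
    where open ≡-Reasoning

  act-multiple : ∀ q {x} → x ∈ ys → act (q * n) x ≡ x
  act-multiple zero    x∈ = act-zero x∈
  act-multiple (suc q) {x} x∈ =
    trans (act-+ n (q * n) x∈) (trans (cong (act n) (act-multiple q x∈)) (act-n x∈))

  act-% : ∀ k {x} → x ∈ ys → act k x ≡ act (k % n) x
  act-% k {x} x∈ = begin
    act k x                           ≡⟨ cong (λ j → act j x) (m≡m%n+[m/n]*n k n) ⟩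
    act (k % n + k / n * n) x         ≡⟨ act-+ (k % n) _ x∈ ⟩
    act (k % n) (act (k / n * n) x)   ≡⟨ cong (act (k % n)) (act-multiple (k / n) x∈) ⟩
    act (k % n) x                     ∎
    where open ≡-Reasoning

  act-≈ : ∀ {a b x} → x ∈ ys → a ≈ b → act a x ≡ act b x
  act-≈ {a} {b} {x} x∈ a≈b = trans (act-% a x∈) (trans (cong (λ j → act j x) a≈b) (sym (act-% b x∈)))

  SameOrbit : X → X → Set
  SameOrbit x z = Any (λ c → act c x ≡ z) (upTo n)

  sameOrbit? : ∀ x z → Dec (SameOrbit x z)
  sameOrbit? x z = any? (λ c → act c x ≟X z) (upTo n)

  sameOrbit-refl : ∀ {x} → x ∈ ys → SameOrbit x x
  sameOrbit-refl x∈ = lose (∈-upTo⁺ 0<M) (act-zero x∈)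

  sameOrbit-act : ∀ a {x z} → x ∈ ys → SameOrbit (act a x) z → SameOrbit x z
  sameOrbit-act a {x} {z} x∈ orb with c , c∈ , eq ← find orb =
    lose (∈-upTo⁺ (m%n<n (c + a) n)) (trans (sym (act-% (c + a) x∈)) (trans (act-+ c a x∈) eq))

  sameOrbit-act⁻ : ∀ a {x z} → x ∈ ys → SameOrbit x z → SameOrbit (act a x) z
  sameOrbit-act⁻ a {x} {z} x∈ orb with c , c∈ , eq ← find orb =
    lose (∈-upTo⁺ (⊖<M c a)) (trans (sym (act-+ (c ⊖ a) a x∈)) (trans (act-≈ x∈ (⊖-+ c a)) eq))

  inOrbitOf : X → X → Bool
  inOrbitOf x z = ⌊ sameOrbit? x z ⌋

  inOrbitOf-act : ∀ a {x} → x ∈ ys → ∀ z → inOrbitOf (act a x) z ≡ inOrbitOf x z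
  inOrbitOf-act a {x} x∈ z with sameOrbit? (act a x) z | sameOrbit? x z
  ... | yes _   | yes _  = refl
  ... | no _    | no _   = refl
  ... | yes orb | no ¬orb = contradiction (sameOrbit-act a x∈ orb) ¬orb
  ... | no ¬orb | yes orb = contradiction (sameOrbit-act⁻ a x∈ orb) ¬orb

  rep : X → X
  rep x = first (inOrbitOf x) ys x

  rep-spec : ∀ {x} → x ∈ ys → rep x ∈ ys × SameOrbit x (rep x)
  rep-spec {x} x∈ with rep∈ , orb ← first-satisfies (inOrbitOf x) x x∈ (⌊⌋-true (sameOrbit? x x) (sameOrbit-refl x∈)) =
    rep∈ , ⌊⌋-true⁻¹ (sameOrbit? x (rep x)) orb

  rep-act : ∀ a {x} → x ∈ ys → rep (act a x) ≡ rep x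
  rep-act a {x} x∈ = trans (first-cong _ _ ys (act a x) (inOrbitOf-act a x∈))
    (first-default (inOrbitOf x) (act a x) x x∈ (⌊⌋-true (sameOrbit? x x) (sameOrbit-refl x∈)))

  toRep : X → ℕ
  toRep x = first (λ c → ⌊ act c x ≟X rep x ⌋) (upTo n) 0

  toRep-spec : ∀ {x} → x ∈ ys → toRep x < n × act (toRep x) x ≡ rep x
  toRep-spec {x} x∈ with c , c∈ , eq ← find (proj₂ (rep-spec x∈))
    with t∈ , t-ok ← first-satisfies (λ c → ⌊ act c x ≟X rep x ⌋) 0 c∈ (⌊⌋-true (act c x ≟X rep x) eq) =
    ∈-upTo⁻ t∈ , ⌊⌋-true⁻¹ (act (toRep x) x ≟X rep x) t-ok

  fromRep : X → ℕ
  fromRep x = 0 ⊖ toRep x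

  fromRep-spec : ∀ {x} → x ∈ ys → act (fromRep x) (rep x) ≡ x
  fromRep-spec {x} x∈ = begin
    act (fromRep x) (rep x)               ≡⟨ cong (act (fromRep x)) (proj₂ (toRep-spec x∈)) ⟨
    act (fromRep x) (act (toRep x) x)     ≡⟨ act-+ (fromRep x) (toRep x) x∈ ⟨
    act (fromRep x + toRep x) x           ≡⟨ act-≈ x∈ (⊖-+ 0 (toRep x)) ⟩
    act 0 x                               ≡⟨ act-zero x∈ ⟩
    x                                     ∎
    where open ≡-Reasoning

  pairs : List (ℕ × X)
  pairs = cartesianProduct (upTo n) ys

  Fixes : ℕ × X → Bool
  Fixes (c , x) = ⌊ act c x ≟X x ⌋

  IsRep : ℕ × X → Bool
  IsRep (_ , y) = ⌊ rep y ≟X y ⌋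

  -- A fixed pair (c, x) corresponds to the pair (a, rep x) where a = fromRep x + c,
  -- so the fixed pairs are as many as n times the number of orbits.
  encode : ℕ × X → ℕ × X
  encode (c , x) = ((fromRep x + c) % n , rep x)

  decode : ℕ × X → ℕ × X
  decode (a , y) = (a ⊖ fromRep (act a y) , act a y)

  rep-idem : ∀ {x} → x ∈ ys → rep (rep x) ≡ rep x
  rep-idem x∈ = trans (cong rep (sym (proj₂ (toRep-spec x∈)))) (rep-act _ x∈)

  encode-into : MapsInto Fixes pairs IsRep pairs encode
  encode-into {c , x} cx∈ _ with _ , x∈ ← ∈-cartesianProduct⁻ (upTo n) ys cx∈ =
    ∈-cartesianProduct⁺ (∈-upTo⁺ (m%n<n _ n)) (proj₁ (rep-spec x∈)) , ⌊⌋-true (rep (rep x) ≟X rep x) (rep-idem x∈)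

  decode∘encode : LeftInverseOn Fixes pairs encode decode
  decode∘encode {c , x} cx∈ fixes with c∈ , x∈ ← ∈-cartesianProduct⁻ (upTo n) ys cx∈ = cong₂ _,_ time lands
    where
    open ≡-Reasoning
    lands : act ((fromRep x + c) % n) (rep x) ≡ x
    lands = begin
      act ((fromRep x + c) % n) (rep x)   ≡⟨ act-≈ (proj₁ (rep-spec x∈)) (trans (%-≈ _) (≡⇒≈ (+-comm (fromRep x) c))) ⟩
      act (c + fromRep x) (rep x)         ≡⟨ act-+ c (fromRep x) (proj₁ (rep-spec x∈)) ⟩
      act c (act (fromRep x) (rep x))     ≡⟨ cong (act c) (fromRep-spec x∈) ⟩
      act c x                             ≡⟨ ⌊⌋-true⁻¹ (act c x ≟X x) fixes ⟩
      x                                   ∎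
    time : (fromRep x + c) % n ⊖ fromRep (act ((fromRep x + c) % n) (rep x)) ≡ c
    time = begin
      (fromRep x + c) % n ⊖ fromRep (act ((fromRep x + c) % n) (rep x))
        ≡⟨ cong (λ z → (fromRep x + c) % n ⊖ fromRep z) lands ⟩
      (fromRep x + c) % n ⊖ fromRep x   ≡⟨ ≈-⊖ (trans (%-≈ _) (≡⇒≈ (+-comm (fromRep x) c))) ⟩
      c % n                             ≡⟨ m<n⇒m%n≡m (∈-upTo⁻ c∈) ⟩
      c                                 ∎

  decode-into : MapsInto IsRep pairs Fixes pairs decode
  decode-into {a , y} ay∈ isRep with _ , y∈ ← ∈-cartesianProduct⁻ (upTo n) ys ay∈ =
    ∈-cartesianProduct⁺ (∈-upTo⁺ (⊖<M _ _)) (act-closed a y∈) , ⌊⌋-true (act c x ≟X x) fixed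
    where
    open ≡-Reasoning
    x = act a y
    c = a ⊖ fromRep x
    rep-x : rep x ≡ y
    rep-x = trans (rep-act a y∈) (⌊⌋-true⁻¹ (rep y ≟X y) isRep)
    fixed : act c x ≡ x
    fixed = begin
      act c x                           ≡⟨ cong (act c) (fromRep-spec (act-closed a y∈)) ⟨
      act c (act (fromRep x) (rep x))   ≡⟨ cong (λ z → act c (act (fromRep x) z)) rep-x ⟩
      act c (act (fromRep x) y)         ≡⟨ act-+ c (fromRep x) y∈ ⟨
      act (c + fromRep x) y             ≡⟨ act-≈ y∈ (⊖-+ a (fromRep x)) ⟩
      act a y                           ∎

  encode∘decode : LeftInverseOn IsRep pairs decode encode
  encode∘decode {a , y} ay∈ isRep with a∈ , y∈ ← ∈-cartesianProduct⁻ (upTo n) ys ay∈ =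
    cong₂ _,_ (≈⇒≡ (m%n<n _ n) (∈-upTo⁻ a∈) time) (trans (rep-act a y∈) (⌊⌋-true⁻¹ (rep y ≟X y) isRep))
    where
    x = act a y
    time : (fromRep x + (a ⊖ fromRep x)) % n ≈ a
    time = trans (%-≈ _) (trans (≡⇒≈ (+-comm (fromRep x) _)) (⊖-+ a (fromRep x)))

  burnside : n ∣ sum (map (λ c → count (λ x → ⌊ act c x ≟X x ⌋) ys) (upTo n))
  burnside = subst (n ∣_) orbits-times-n (m∣m*n orbits)
    where
    open ≡-Reasoning
    orbits = count (λ y → ⌊ rep y ≟X y ⌋) ys
    _≟P_ : DecidableEquality (ℕ × X)
    _≟P_ = Product.≡-dec _≟_ _≟X_
    pairs-unique : Unique pairs
    pairs-unique = Unique.cartesianProduct⁺ (Unique.upTo⁺ n) ys-unique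
    orbits-times-n : n * orbits ≡ sum (map (λ c → count (λ x → ⌊ act c x ≟X x ⌋) ys) (upTo n))
    orbits-times-n = begin
      n * orbits                             ≡⟨ cong (_* orbits) (length-upTo n) ⟨
      length (upTo n) * orbits               ≡⟨ sum-map-const orbits (upTo n) ⟨
      sum (map (λ _ → orbits) (upTo n))      ≡⟨ count-cartesianProduct IsRep (upTo n) ys ⟨
      count IsRep pairs                      ≡⟨ count-bijection _≟P_ _≟P_ Fixes IsRep encode decode
                                                  pairs-unique pairs-unique encode-into decode-into
                                                  decode∘encode encode∘decode ⟨
      count Fixes pairs                      ≡⟨ count-cartesianProduct Fixes (upTo n) ys ⟩
      sum (map (λ c → count (λ x → ⌊ act c x ≟X x ⌋) ys) (upTo n)) ∎

-- The shift action on normalised permutations of ℤ/n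

_≟L_ : DecidableEquality (List ℕ)
_≟L_ = ≡-dec _≟_

module Shift (n : ℕ) .{{_ : NonZero n}} where

  open Modulo n

  -- A permutation π of ℤ/n is stored as the list [π 0, …, π (n − 1)]; `at π`
  -- reads it as an n-periodic function on ℕ.
  at : List ℕ → ℕ → ℕ
  at π x = nth π (x % n)

  Normalized : List ℕ → Set
  Normalized π = nth π 0 ≡ 0 × distinct π ≡ true

  normalized? : U.Decidable Normalized
  normalized? π = (nth π 0 ≟ 0) ×-dec (distinct π Bool.≟ true)

  perms : List (List ℕ)
  perms = filter normalized? (tuples n n)

  module _ {π : List ℕ} (π∈ : π ∈ perms) where

    private
      tuple : π ∈ tuples n n × Normalized π
      tuple = ∈-filter⁻ normalized? π∈

    perm-length : length π ≡ n
    perm-length = proj₁ (∈-tuples⁻ {k = n} (proj₁ tuple))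

    perm-0 : nth π 0 ≡ 0
    perm-0 = proj₁ (proj₂ tuple)

    perm-< : ∀ x → nth π x < n
    perm-< = nth-< 0<M (proj₂ (∈-tuples⁻ {k = n} (proj₁ tuple)))

    perm-injective : ∀ {a b} → a < n → b < n → nth π a ≡ nth π b → a ≡ b
    perm-injective a<n b<n = distinct⇒nth-injective π (proj₂ (proj₂ tuple))
      (subst (_ <_) (sym perm-length) a<n) (subst (_ <_) (sym perm-length) b<n)

  ∈-perms⁺ : ∀ {π} → length π ≡ n → All (_< n) π → nth π 0 ≡ 0 → distinct π ≡ true → π ∈ perms
  ∈-perms⁺ len bounded zero-0 dist = ∈-filter⁺ normalized? (∈-tuples⁺ len bounded) (zero-0 , dist)

  at-≈ : ∀ π {a b} → a ≈ b → at π a ≡ at π b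
  at-≈ π = cong (nth π)

  at-< : ∀ π {x} → x < n → at π x ≡ nth π x
  at-< π x<n = cong (nth π) (m<n⇒m%n≡m x<n)

  at-0 : ∀ {π} → π ∈ perms → at π 0 ≡ 0
  at-0 {π} π∈ = trans (at-< π 0<M) (perm-0 π∈)

  shift : ℕ → List ℕ → List ℕ
  shift c π = applyUpTo (λ x → at π (x + c) ⊖ at π c) n

  nth-shift : ∀ c π {x} → x < n → nth (shift c π) x ≡ at π (x + c) ⊖ at π c
  nth-shift c π = nth-applyUpTo _

  at-shift : ∀ c π y → at (shift c π) y ≡ at π (y + c) ⊖ at π c
  at-shift c π y = trans (nth-shift c π (m%n<n y n)) (cong (_⊖ at π c) (at-≈ π (≈-+ (%-≈ y) refl)))

  shift-∈ : ∀ c {π} → π ∈ perms → shift c π ∈ perms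
  shift-∈ c {π} π∈ = ∈-perms⁺ (length-applyUpTo _ n) (applyUpTo⁺₁ _ n (λ _ → ⊖<M _ _))
    (trans (nth-shift c π 0<M) (⊖-self (at π c)))
    (nth-injective⇒distinct (shift c π) injective)
    where
    injective : NthInjective (shift c π)
    injective {i} {j} i< j< eq = ≈⇒≡ i<n j<n (≈-cancelʳ-+ c (perm-injective π∈ (m%n<n (i + c) n) (m%n<n (j + c) n) at-eq))
      where
      i<n = subst (i <_) (length-applyUpTo _ n) i<
      j<n = subst (j <_) (length-applyUpTo _ n) j<
      at-eq : at π (i + c) ≡ at π (j + c)
      at-eq = ≈⇒≡ (perm-< π∈ _) (perm-< π∈ _)
        (⊖-injectiveˡ (at π c) (trans (sym (nth-shift c π i<n)) (trans eq (nth-shift c π j<n))))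

  shift-+ : ∀ a b {π} → π ∈ perms → shift (a + b) π ≡ shift a (shift b π)
  shift-+ a b {π} π∈ = nth-ext (length-applyUpTo _ n) (length-applyUpTo _ n) λ {x} x<n → begin
    nth (shift (a + b) π) x                                 ≡⟨ nth-shift (a + b) π x<n ⟩
    at π (x + (a + b)) ⊖ at π (a + b)                       ≡⟨ cong (λ y → at π y ⊖ at π (a + b)) (+-assoc x a b) ⟨
    at π (x + a + b) ⊖ at π (a + b)                         ≡⟨ ⊖-⊖ _ _ (at π b) ⟨
    (at π (x + a + b) ⊖ at π b) ⊖ (at π (a + b) ⊖ at π b)   ≡⟨ cong₂ _⊖_ (at-shift b π (x + a)) (at-shift b π a) ⟨
    at (shift b π) (x + a) ⊖ at (shift b π) a               ≡⟨ nth-shift a (shift b π) x<n ⟨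
    nth (shift a (shift b π)) x                             ∎
    where open ≡-Reasoning

  shift-n : ∀ {π} → π ∈ perms → shift n π ≡ π
  shift-n {π} π∈ = nth-ext (length-applyUpTo _ n) (perm-length π∈) λ {x} x<n → begin
    nth (shift n π) x               ≡⟨ nth-shift n π x<n ⟩
    at π (x + n) ⊖ at π n           ≡⟨ cong₂ _⊖_ (at-≈ π ([m+n]%n≡m%n x n)) (at-≈ π M≈0) ⟩
    at π x ⊖ at π 0                 ≡⟨ cong₂ _⊖_ (at-< π x<n) (at-0 π∈) ⟩
    nth π x ⊖ 0                     ≡⟨ ⊖-identityʳ (perm-< π∈ x) ⟩
    nth π x                         ∎
    where open ≡-Reasoning

  Additive : ℕ → List ℕ → Set
  Additive c π = ∀ x → at π (x + c) ≈ at π x + at π c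

  fixed⇒additive : ∀ c {π} → π ∈ perms → shift c π ≡ π → Additive c π
  fixed⇒additive c {π} π∈ fixed x = begin
    at π (x + c)                          ≈⟨ ⊖-+ (at π (x + c)) (at π c) ⟨
    at π (x + c) ⊖ at π c + at π c        ≡⟨ cong (_+ at π c) (at-shift c π x) ⟨
    at (shift c π) x + at π c             ≡⟨ cong (λ σ → at σ x + at π c) fixed ⟩
    at π x + at π c                       ∎
    where open ≈-Reasoning

  additive⇒fixed : ∀ c {π} → π ∈ perms → Additive c π → shift c π ≡ π
  additive⇒fixed c {π} π∈ additive = nth-ext (length-applyUpTo _ n) (perm-length π∈) λ {x} x<n → begin
    nth (shift c π) x             ≡⟨ nth-shift c π x<n ⟩
    at π (x + c) ⊖ at π c         ≡⟨ ≈-⊖ (additive x) ⟩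
    at π x % n                    ≡⟨ m<n⇒m%n≡m (perm-< π∈ _) ⟩
    at π x                        ≡⟨ at-< π x<n ⟩
    nth π x                       ∎
    where open ≡-Reasoning

  additive-iterate : ∀ {c π} → Additive c π → ∀ j x → at π (x + j * c) ≈ at π x + j * at π c
  additive-iterate {c} {π} additive zero    x = ≡⇒≈ (trans (cong (at π) (+-identityʳ x)) (sym (+-identityʳ _)))
  additive-iterate {c} {π} additive (suc j) x = begin
    at π (x + (c + j * c))                ≡⟨ cong (at π) (reassoc x c (j * c)) ⟩
    at π (x + j * c + c)                  ≈⟨ additive (x + j * c) ⟩
    at π (x + j * c) + at π c             ≈⟨ ≈-+ {c = at π c} (additive-iterate {c} {π} additive j x) refl ⟩
    at π x + j * at π c + at π c          ≡⟨ reassoc′ (at π x) (at π c) (j * at π c) ⟩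
    at π x + (at π c + j * at π c)        ∎
    where
    open ≈-Reasoning
    reassoc : ∀ x a b → x + (a + b) ≡ x + b + a
    reassoc = solve-∀
    reassoc′ : ∀ x a b → x + b + a ≡ x + (a + b)
    reassoc′ = solve-∀

  additive-multiple : ∀ {a b π} k → π ∈ perms → Additive a π → b ≈ k * a → Additive b π
  additive-multiple {a} {b} {π} k π∈ additive b≈ka x = begin
    at π (x + b)                  ≡⟨ at-≈ π (≈-+ {x} refl b≈ka) ⟩
    at π (x + k * a)              ≈⟨ additive-iterate {a} {π} additive k x ⟩
    at π x + k * at π a           ≈⟨ ≈-+ {at π x} refl at-b ⟨
    at π x + at π b               ∎
    where
    open ≈-Reasoning
    at-b : at π b ≈ k * at π a
    at-b = begin
      at π b                      ≡⟨ at-≈ π b≈ka ⟩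
      at π (0 + k * a)            ≈⟨ additive-iterate {a} {π} additive k 0 ⟩
      at π 0 + k * at π a         ≡⟨ cong (_+ k * at π a) (at-0 π∈) ⟩
      k * at π a                  ∎

  additive-gcd : ∀ c {π} → π ∈ perms → Additive c π → Additive (gcd c n) π
  additive-gcd c π∈ additive with k , kc≈g ← bézout-inverse c = additive-multiple k π∈ additive (sym kc≈g)

  additive-gcd⁻¹ : ∀ c {π} → π ∈ perms → Additive (gcd c n) π → Additive c π
  additive-gcd⁻¹ c π∈ additive with divides q c≡qg ← gcd[m,n]∣m c n = additive-multiple q π∈ additive (≡⇒≈ c≡qg)

  at-injective : ∀ {π a b} → π ∈ perms → at π a ≡ at π b → a ≈ b
  at-injective π∈ = perm-injective π∈ (m%n<n _ n) (m%n<n _ n)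

  at-multiple : ∀ {c π} → π ∈ perms → Additive c π → ∀ k → at π (k * c) ≈ k * at π c
  at-multiple {c} {π} π∈ additive k =
    trans (additive-iterate {c} {π} additive k 0) (≡⇒≈ (cong (_+ k * at π c) (at-0 π∈)))

  fixedCount : ℕ → ℕ
  fixedCount c = count (λ π → ⌊ shift c π ≟L π ⌋) perms

  fixedCount-gcd : ∀ c → fixedCount c ≡ fixedCount (gcd c n)
  fixedCount-gcd c = count-cong _ _ perms λ {π} π∈ → ⌊⌋-⇔
    (λ fixed → additive⇒fixed _ π∈ (additive-gcd c π∈ (fixed⇒additive c π∈ fixed)))
    (λ fixed → additive⇒fixed c π∈ (additive-gcd⁻¹ c π∈ (fixed⇒additive _ π∈ fixed)))
    (shift c π ≟L π) (shift (gcd c n) π ≟L π)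

  n∣fixedCounts : n ∣ sum (map fixedCount (upTo n))
  n∣fixedCounts = CyclicBurnside.burnside _≟L_ n shift (Unique.filter⁺ _ (tuples-unique n n))
    (λ c → shift-∈ c) shift-+ shift-n

-- Permutations fixed by the shift by a divisor

module ShiftByDivisor (m g : ℕ) .{{_ : NonZero m}} .{{_ : NonZero g}} where

  n : ℕ
  n = m * g

  instance
    n≢0 : NonZero n
    n≢0 = m*n≢0 m g

  open Shift n
  open Modulo n
  module Modᵍ = Modulo g
  module Modᵐ = Modulo m

  g∣n : g ∣ n
  g∣n = n∣m*n m

  g≤n : g ≤ n
  g≤n = m≤n*m g m

  -- A permutation with π (x + g) = π x + u is determined by u and its first
  -- block w = [π 0, …, π (g − 1)], through π (r + q g) = w r + q u.
  extend : ℕ → List ℕ → ℕ → ℕ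
  extend u w x = (nth w (x % g) + x / g * u) % n

  assemble : ℕ × List ℕ → List ℕ
  assemble (u , w) = applyUpTo (extend u w) n

  split : List ℕ → ℕ × List ℕ
  split π = (at π g , applyUpTo (nth π) g)

  isBlock : List ℕ → Bool
  isBlock w = ⌊ nth w 0 ≟ 0 ⌋ ∧ distinct (map (_% g) w)

  admissible : ℕ × List ℕ → Bool
  admissible (u , w) = ⌊ gcd u n ≟ g ⌋ ∧ isBlock w

  blockPairs : List (ℕ × List ℕ)
  blockPairs = cartesianProduct (upTo n) (tuples n g)

  module AdmissiblePair {u : ℕ} {w : List ℕ} (uw∈ : (u , w) ∈ blockPairs) (adm : admissible (u , w) ≡ true) where

    u<n : u < n
    u<n = ∈-upTo⁻ (proj₁ (∈-cartesianProduct⁻ (upTo n) (tuples n g) uw∈))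

    w∈ : w ∈ tuples n g
    w∈ = proj₂ (∈-cartesianProduct⁻ (upTo n) (tuples n g) uw∈)

    gcd-u : gcd u n ≡ g
    gcd-u = ⌊⌋-true⁻¹ (gcd u n ≟ g) (∧-true⁻ˡ adm)

    w-0 : nth w 0 ≡ 0
    w-0 = ⌊⌋-true⁻¹ (nth w 0 ≟ 0) (∧-true⁻ˡ (∧-true⁻ʳ {⌊ gcd u n ≟ g ⌋} adm))

    w-distinct : distinct (map (_% g) w) ≡ true
    w-distinct = ∧-true⁻ʳ {⌊ nth w 0 ≟ 0 ⌋} (∧-true⁻ʳ {⌊ gcd u n ≟ g ⌋} adm)

    g∣u : g ∣ u
    g∣u = subst (_∣ u) gcd-u (gcd[m,n]∣m u n)

    u′ : ℕ
    u′ = _∣_.quotient g∣u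

    u≡u′g : u ≡ u′ * g
    u≡u′g = _∣_.equality g∣u

    m*u≈0 : m * u ≈ 0
    m*u≈0 = trans (≡⇒≈ (trans (cong (m *_) u≡u′g) (reassoc m u′ g))) (multiple-≈0 u′)
      where
      reassoc : ∀ m u′ g → m * (u′ * g) ≡ u′ * (m * g)
      reassoc = solve-∀

    quotient-% : ∀ y → y / g ≡ (y % n) / g + y / n * m
    quotient-% y = begin
      y / g                                 ≡⟨ /-congˡ (trans (m≡m%n+[m/n]*n y n) (cong (y % n +_) (sym (*-assoc (y / n) m g)))) ⟩
      (y % n + y / n * m * g) / g           ≡⟨ +-distrib-/-∣ʳ (y % n) (n∣m*n (y / n * m)) ⟩
      (y % n) / g + y / n * m * g / g       ≡⟨ cong ((y % n) / g +_) (m*n/n≡m (y / n * m) g) ⟩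
      (y % n) / g + y / n * m               ∎
      where open ≡-Reasoning

    extend-periodic : ∀ y → extend u w (y % n) ≡ extend u w y
    extend-periodic y = ≈-+ (cong (λ r → nth w r % n) (m∣n⇒o%n%m≡o%m g n y g∣n)) (sym (begin
      y / g * u                             ≡⟨ cong (_* u) (quotient-% y) ⟩
      ((y % n) / g + y / n * m) * u         ≡⟨ expand ((y % n) / g) (y / n) m u ⟩
      (y % n) / g * u + y / n * (m * u)     ≈⟨ ≈-+ {(y % n) / g * u} refl (≈-* {y / n} refl m*u≈0) ⟩
      (y % n) / g * u + y / n * 0           ≡⟨ cong ((y % n) / g * u +_) (*-zeroʳ (y / n)) ⟩
      (y % n) / g * u + 0                   ≡⟨ +-identityʳ _ ⟩
      (y % n) / g * u                       ∎))
      where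
      open ≈-Reasoning
      expand : ∀ a t m u → (a + t * m) * u ≡ a * u + t * (m * u)
      expand = solve-∀

    extend-step : ∀ x → extend u w (x + g) ≈ extend u w x + u
    extend-step x = begin
      extend u w (x + g)                            ≈⟨ %-≈ _ ⟩
      nth w ((x + g) % g) + (x + g) / g * u
        ≡⟨ cong₂ (λ r q → nth w r + q * u) ([m+n]%n≡m%n x g) (+-distrib-/-∣ʳ x (∣-refl {g})) ⟩
      nth w (x % g) + (x / g + g / g) * u           ≡⟨ cong (λ q → nth w (x % g) + (x / g + q) * u) (n/n≡1 g) ⟩
      nth w (x % g) + (x / g + 1) * u               ≡⟨ expand (nth w (x % g)) (x / g) u ⟩
      nth w (x % g) + x / g * u + u                 ≈⟨ ≈-+ (%-≈ (nth w (x % g) + x / g * u)) refl ⟨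
      extend u w x + u                              ∎
      where
      open ≈-Reasoning
      expand : ∀ a q u → a + (q + 1) * u ≡ a + q * u + u
      expand = solve-∀

    w-< : ∀ r → nth w r < n
    w-< = nth-< 0<M (proj₂ (∈-tuples⁻ {k = g} w∈))

    extend-block : ∀ {r} → r < g → extend u w r ≡ nth w r
    extend-block {r} r<g = begin
      (nth w (r % g) + r / g * u) % n   ≡⟨ cong₂ (λ a q → (nth w a + q * u) % n) (m<n⇒m%n≡m r<g) (m<n⇒m/n≡0 r<g) ⟩
      (nth w r + 0) % n                 ≡⟨ cong (_% n) (+-identityʳ (nth w r)) ⟩
      nth w r % n                       ≡⟨ m<n⇒m%n≡m (w-< r) ⟩
      nth w r                           ∎
      where open ≡-Reasoning

    extend-g : extend u w g ≡ u
    extend-g = begin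
      (nth w (g % g) + g / g * u) % n   ≡⟨ cong₂ (λ a q → (nth w a + q * u) % n) (n%n≡0 g) (n/n≡1 g) ⟩
      (nth w 0 + 1 * u) % n             ≡⟨ cong (λ a → (a + 1 * u) % n) w-0 ⟩
      (1 * u) % n                       ≡⟨ cong (_% n) (*-identityˡ u) ⟩
      u % n                             ≡⟨ m<n⇒m%n≡m u<n ⟩
      u                                 ∎
      where open ≡-Reasoning

    w-length : length w ≡ g
    w-length = proj₁ (∈-tuples⁻ {k = g} w∈)

    extend-residue : ∀ x → extend u w x % g ≡ nth w (x % g) % g
    extend-residue x = begin
      extend u w x % g                          ≡⟨ m∣n⇒o%n%m≡o%m g n _ g∣n ⟩
      (nth w (x % g) + x / g * u) % g
        ≡⟨ cong (λ v → (nth w (x % g) + v) % g) (trans (cong (x / g *_) u≡u′g) (sym (*-assoc (x / g) u′ g))) ⟩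
      (nth w (x % g) + x / g * u′ * g) % g      ≡⟨ [m+kn]%n≡m%n (nth w (x % g)) (x / g * u′) g ⟩
      nth w (x % g) % g                         ∎
      where open ≡-Reasoning

    u′-coprime : gcd u′ m ≡ 1
    u′-coprime = *-cancelˡ-≡ _ 1 g (begin
      g * gcd u′ m           ≡⟨ c*gcd[m,n]≡gcd[cm,cn] g u′ m ⟩
      gcd (g * u′) (g * m)   ≡⟨ cong₂ gcd (trans (*-comm g u′) (sym u≡u′g)) (*-comm g m) ⟩
      gcd u n                ≡⟨ gcd-u ⟩
      g                      ≡⟨ *-identityʳ g ⟨
      g * 1                  ∎)
      where open ≡-Reasoning

    extend-injective : ∀ {i j} → i < n → j < n → extend u w i ≡ extend u w j → i ≡ j
    extend-injective {i} {j} i<n j<n eq = begin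
      i                     ≡⟨ m≡m%n+[m/n]*n i g ⟩
      i % g + i / g * g     ≡⟨ cong₂ (λ r q → r + q * g) same-residue same-quotient ⟩
      j % g + j / g * g     ≡⟨ m≡m%n+[m/n]*n j g ⟨
      j                     ∎
      where
      open ≡-Reasoning
      residue< : ∀ x → x % g < length (map (_% g) w)
      residue< x = subst (x % g <_) (sym (trans (length-map (_% g) w) w-length)) (m%n<n x g)
      nth-residue : ∀ x → nth (map (_% g) w) (x % g) ≡ extend u w x % g
      nth-residue x = trans (nth-map (_% g) {w} (subst (x % g <_) (sym w-length) (m%n<n x g))) (sym (extend-residue x))
      same-residue : i % g ≡ j % g
      same-residue = distinct⇒nth-injective (map (_% g) w) w-distinct (residue< i) (residue< j)
        (trans (nth-residue i) (trans (cong (_% g) eq) (sym (nth-residue j))))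
      same-multiple : i / g * u ≈ j / g * u
      same-multiple = ≈-cancelˡ-+ (nth w (i % g)) (trans eq (cong (λ r → (nth w r + j / g * u) % n) (sym same-residue)))
      scaled : ∀ a → a * u′ % m * g ≡ a * u % n
      scaled a = trans (m%n*o≡m*o%[n*o] (a * u′) m g) (cong (_% n) (trans (*-assoc a u′ g) (cong (a *_) (sym u≡u′g))))
      same-quotient : i / g ≡ j / g
      same-quotient = Modᵐ.≈⇒≡ (m<n*o⇒m/o<n i<n) (m<n*o⇒m/o<n j<n) (Modᵐ.≈-cancelʳ-* u′-coprime
        (*-cancelʳ-≡ _ _ g (trans (scaled (i / g)) (trans same-multiple (sym (scaled (j / g)))))))

    at-assemble : ∀ y → at (assemble (u , w)) y ≡ extend u w y
    at-assemble y = trans (nth-applyUpTo (extend u w) (m%n<n y n)) (extend-periodic y)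

    assemble-∈ : assemble (u , w) ∈ perms
    assemble-∈ = ∈-perms⁺ (length-applyUpTo _ n) (applyUpTo⁺₁ _ n (λ _ → m%n<n _ n))
      (trans (nth-applyUpTo (extend u w) 0<M) (trans (extend-block (>-nonZero⁻¹ g)) w-0))
      (nth-injective⇒distinct (assemble (u , w)) injective)
      where
      injective : NthInjective (assemble (u , w))
      injective {i} {j} i< j< eq = extend-injective i<n j<n
        (trans (sym (nth-applyUpTo (extend u w) i<n)) (trans eq (nth-applyUpTo (extend u w) j<n)))
        where
        i<n = subst (i <_) (length-applyUpTo _ n) i<
        j<n = subst (j <_) (length-applyUpTo _ n) j<

    assemble-additive : Additive g (assemble (u , w))
    assemble-additive x = begin
      at (assemble (u , w)) (x + g)                   ≡⟨ at-assemble (x + g) ⟩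
      extend u w (x + g)                              ≈⟨ extend-step x ⟩
      extend u w x + u                                ≡⟨ cong₂ _+_ (at-assemble x) (trans (at-assemble g) extend-g) ⟨
      at (assemble (u , w)) x + at (assemble (u , w)) g ∎
      where open ≈-Reasoning

    split-assemble : split (assemble (u , w)) ≡ (u , w)
    split-assemble = cong₂ _,_ (trans (at-assemble g) extend-g)
      (nth-ext (length-applyUpTo _ g) w-length λ {r} r<g → begin
        nth (applyUpTo (nth (assemble (u , w))) g) r    ≡⟨ nth-applyUpTo _ r<g ⟩
        nth (assemble (u , w)) r                         ≡⟨ nth-applyUpTo (extend u w) (<-≤-trans r<g g≤n) ⟩
        extend u w r                                     ≡⟨ extend-block r<g ⟩
        nth w r                                          ∎)
      where open ≡-Reasoning

  module FixedPermutation {π : List ℕ} (π∈ : π ∈ perms) (additive : Additive g π) where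

    step : ℕ
    step = at π g

    g∣step : g ∣ step
    g∣step = *-cancelˡ-∣ m (≈0⇒∣ (begin
      m * step     ≈⟨ at-multiple π∈ additive m ⟨
      at π n       ≡⟨ at-≈ π M≈0 ⟩
      at π 0       ≡⟨ at-0 π∈ ⟩
      0            ∎))
      where open ≈-Reasoning

    gcd-step : gcd step n ≡ g
    gcd-step with divides k n≡ke ← gcd[m,n]∣n step n | divides t step≡te ← gcd[m,n]∣m step n =
      ∣-antisym (*-cancelˡ-∣ k {{k≢0}} (subst (_∣ k * g) n≡ke (≈0⇒∣ kg≈0))) (gcd-greatest g∣step g∣n)
      where
      e = gcd step n
      k≢0 : NonZero k
      k≢0 = ≢-nonZero λ { refl → ≢-nonZero⁻¹ n n≡ke }
      swap : ∀ k t e → k * (t * e) ≡ t * (k * e)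
      swap = solve-∀
      k*step≈0 : k * step ≈ 0
      k*step≈0 = begin
        k * step         ≡⟨ cong (k *_) step≡te ⟩
        k * (t * e)      ≡⟨ swap k t e ⟩
        t * (k * e)      ≡⟨ cong (t *_) n≡ke ⟨
        t * n            ≈⟨ multiple-≈0 t ⟩
        0                ∎
        where open ≈-Reasoning
      kg≈0 : k * g ≈ 0
      kg≈0 = at-injective π∈ (≈⇒≡ (perm-< π∈ _) (perm-< π∈ _)
        (trans (at-multiple π∈ additive k) (trans k*step≈0 (sym (≡⇒≈ (at-0 π∈))))))

    residues-injective : ∀ {i j} → i < g → j < g → nth π i % g ≡ nth π j % g → i ≡ j
    residues-injective {i} {j} i<g j<g i≡j[g] = i≡j
      where
      δ = nth π i ⊖ nth π j
      g∣δ : g ∣ δ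
      g∣δ = Modᵍ.≈0⇒∣ (Modᵍ.≈-cancelʳ-+ (nth π j)
              (trans (≈⇒%-divisor g∣n (⊖-+ (nth π i) (nth π j))) i≡j[g]))
      q = _∣_.quotient g∣δ
      k = proj₁ (bézout-inverse step)
      k*step≈g : k * step ≈ g
      k*step≈g = trans (proj₂ (bézout-inverse step)) (≡⇒≈ gcd-step)
      lands-at : at π (j + q * k * g) ≈ at π i
      lands-at = begin
        at π (j + q * k * g)        ≈⟨ additive-iterate {g} {π} additive (q * k) j ⟩
        at π j + q * k * step       ≡⟨ cong₂ _+_ (at-< π (<-≤-trans j<g g≤n)) (*-assoc q k step) ⟩
        nth π j + q * (k * step)    ≈⟨ ≈-+ {nth π j} refl (≈-* {q} refl k*step≈g) ⟩
        nth π j + q * g             ≡⟨ cong (nth π j +_) (_∣_.equality g∣δ) ⟨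
        nth π j + δ                 ≡⟨ +-comm (nth π j) δ ⟩
        δ + nth π j                 ≈⟨ ⊖-+ (nth π i) (nth π j) ⟩
        nth π i                     ≡⟨ at-< π (<-≤-trans i<g g≤n) ⟨
        at π i                      ∎
        where open ≈-Reasoning
      i≡j : i ≡ j
      i≡j = begin
        i                     ≡⟨ m<n⇒m%n≡m i<g ⟨
        i % g                 ≡⟨ ≈⇒%-divisor g∣n (at-injective π∈ (≈⇒≡ (perm-< π∈ _) (perm-< π∈ _) lands-at)) ⟨
        (j + q * k * g) % g   ≡⟨ [m+kn]%n≡m%n j (q * k) g ⟩
        j % g                 ≡⟨ m<n⇒m%n≡m j<g ⟩
        j                     ∎
        where open ≡-Reasoning

    u<n : step < n
    u<n = perm-< π∈ _

    block : List ℕ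
    block = applyUpTo (nth π) g

    block-length : length block ≡ g
    block-length = length-applyUpTo _ g

    nth-block : ∀ {r} → r < g → nth block r ≡ nth π r
    nth-block = nth-applyUpTo (nth π)

    block-0 : nth block 0 ≡ 0
    block-0 = trans (nth-block (>-nonZero⁻¹ g)) (perm-0 π∈)

    block-distinct : distinct (map (_% g) block) ≡ true
    block-distinct = nth-injective⇒distinct (map (_% g) block) λ {i} {j} i< j< eq →
      let i<g = subst (i <_) (trans (length-map (_% g) block) block-length) i<
          j<g = subst (j <_) (trans (length-map (_% g) block) block-length) j<
          residue : ∀ {r} → r < g → nth (map (_% g) block) r ≡ nth π r % g
          residue r<g = trans (nth-map (_% g) {block} (subst (_ <_) (sym block-length) r<g)) (cong (_% g) (nth-block r<g))
      in residues-injective i<g j<g (trans (sym (residue i<g)) (trans eq (residue j<g)))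

    block-∈ : block ∈ tuples n g
    block-∈ = ∈-tuples⁺ block-length (applyUpTo⁺₁ _ g (λ _ → perm-< π∈ _))

    assemble-split : assemble (split π) ≡ π
    assemble-split = nth-ext (length-applyUpTo _ n) (perm-length π∈) λ {x} x<n →
      ≈⇒≡ (subst (_< n) (sym (nth-applyUpTo (extend step block) x<n)) (m%n<n _ n)) (perm-< π∈ x) (begin
        nth (assemble (split π)) x                ≡⟨ nth-applyUpTo (extend step block) x<n ⟩
        (nth block (x % g) + x / g * step) % n    ≈⟨ %-≈ _ ⟩
        nth block (x % g) + x / g * step          ≡⟨ cong (_+ x / g * step) (trans (nth-block (m%n<n x g)) (sym (at-< π (<-≤-trans (m%n<n x g) g≤n)))) ⟩
        at π (x % g) + x / g * step               ≈⟨ additive-iterate {g} {π} additive (x / g) (x % g) ⟨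
        at π (x % g + x / g * g)                  ≡⟨ cong (at π) (m≡m%n+[m/n]*n x g) ⟨
        at π x                                    ≡⟨ at-< π x<n ⟩
        nth π x                                   ∎)
      where open ≈-Reasoning

  isFixed : List ℕ → Bool
  isFixed π = ⌊ shift g π ≟L π ⌋

  fixed-additive : ∀ {π} → π ∈ perms → isFixed π ≡ true → Additive g π
  fixed-additive {π} π∈ fixed = fixed⇒additive g π∈ (⌊⌋-true⁻¹ (shift g π ≟L π) fixed)

  split-into : MapsInto isFixed perms admissible blockPairs split
  split-into π∈ fixed = ∈-cartesianProduct⁺ (∈-upTo⁺ u<n) block-∈ ,
    ∧-true (⌊⌋-true (gcd step n ≟ g) gcd-step) (∧-true (⌊⌋-true (nth block 0 ≟ 0) block-0) block-distinct)
    where open FixedPermutation π∈ (fixed-additive π∈ fixed)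

  assemble∘split : LeftInverseOn isFixed perms split assemble
  assemble∘split π∈ fixed = FixedPermutation.assemble-split π∈ (fixed-additive π∈ fixed)

  assemble-into : MapsInto admissible blockPairs isFixed perms assemble
  assemble-into {u , w} uw∈ adm =
    assemble-∈ , ⌊⌋-true (shift g (assemble (u , w)) ≟L assemble (u , w))
                          (additive⇒fixed g assemble-∈ assemble-additive)
    where open AdmissiblePair uw∈ adm

  split∘assemble : LeftInverseOn admissible blockPairs assemble split
  split∘assemble uw∈ adm = AdmissiblePair.split-assemble uw∈ adm

  fixedCount≡count-admissible : fixedCount g ≡ count admissible blockPairs
  fixedCount≡count-admissible = count-bijection _≟L_ (Product.≡-dec _≟_ _≟L_) isFixed admissible split assemble
    (Unique.filter⁺ _ (tuples-unique n n)) (Unique.cartesianProduct⁺ (Unique.upTo⁺ n) (tuples-unique n g))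
    split-into assemble-into assemble∘split split∘assemble

  count-admissible : count admissible blockPairs ≡ count (λ u → ⌊ gcd u n ≟ g ⌋) (upTo n) * count isBlock (tuples n g)
  count-admissible = trans (count-cartesianProduct admissible (upTo n) (tuples n g))
    (sum-if (λ u → ⌊ gcd u n ≟ g ⌋) (count isBlock (tuples n g)) _ (upTo n) λ {u} _ → by-gcd u)
    where
    by-gcd : ∀ u → count (λ w → admissible (u , w)) (tuples n g) ≡
                   (if ⌊ gcd u n ≟ g ⌋ then count isBlock (tuples n g) else 0)
    by-gcd u with gcd u n ≟ g
    ... | yes _ = refl
    ... | no _  = count-none _ (tuples n g) (λ _ → refl)

-- Counting the first blocks

count-at-0 : ∀ {N} → 0 < N → (p : ℕ → Bool) → count (λ x → ⌊ x ≟ 0 ⌋ ∧ p x) (upTo N) ≡ (if p 0 then 1 else 0)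
count-at-0 {suc N} _ p = cong (λ c → if p 0 then suc c else c) (count-none _ _ positive)
  where
  positive : ∀ {x} → x ∈ applyUpTo suc N → ⌊ x ≟ 0 ⌋ ∧ p x ≡ false
  positive x∈ with _ , _ , refl ← ∈-applyUpTo⁻ suc x∈ = refl

P′-! : ∀ e → e P′ e ≡ e !
P′-! zero    = refl
P′-! (suc e) = trans (nP′k≡n[n∸1P′k∸1] (suc e) (suc e)) (cong (suc e *_) (P′-! e))

module Blocks (m e : ℕ) .{{_ : NonZero m}} where

  open ShiftByDivisor m (suc e)

  tailIsBlock : List ℕ → Bool
  tailIsBlock v = distinct (0 ∷ map (_% suc e) v)

  count-isBlock : count isBlock (tuples n (suc e)) ≡ count tailIsBlock (tuples n e)
  count-isBlock = trans (count-tuples isBlock n e)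
    (trans (sum-if tailIsBlock 1 _ (tuples n e) λ {v} _ → count-at-0 (>-nonZero⁻¹ n) (λ x → distinct (x % suc e ∷ map (_% suc e) v)))
           (*-identityʳ _))

  tailIsBlock-∷ : ∀ x v → tailIsBlock (x ∷ v) ≡ not (x % suc e ∈ᵇ (0 ∷ map (_% suc e) v)) ∧ tailIsBlock v
  tailIsBlock-∷ x v = distinct-swap 0 (x % suc e) (map (_% suc e) v)

  count-tailIsBlock : ∀ k → k ≤ e → count tailIsBlock (tuples n k) ≡ m ^ k * (e P′ k)
  count-tailIsBlock zero    _   = refl
  count-tailIsBlock (suc k) k<e = begin
    count tailIsBlock (tuples n (suc k))                ≡⟨ count-tuples tailIsBlock n k ⟩
    sum (map (λ v → count (λ x → tailIsBlock (x ∷ v)) (upTo n)) (tuples n k))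
      ≡⟨ sum-if tailIsBlock (m * (e ∸ k)) _ (tuples n k) extensions ⟩
    count tailIsBlock (tuples n k) * (m * (e ∸ k))     ≡⟨ cong (_* (m * (e ∸ k))) (count-tailIsBlock k (<⇒≤ k<e)) ⟩
    m ^ k * (e P′ k) * (m * (e ∸ k))                    ≡⟨ reorder (m ^ k) (e P′ k) m (e ∸ k) ⟩
    m ^ suc k * (e P′ suc k)                            ∎
    where
    open ≡-Reasoning
    reorder : ∀ a p m d → a * p * (m * d) ≡ m * a * (d * p)
    reorder = solve-∀
    extensions : ∀ {v} → v ∈ tuples n k →
      count (λ x → tailIsBlock (x ∷ v)) (upTo n) ≡ (if tailIsBlock v then m * (e ∸ k) else 0)
    extensions {v} v∈ with tailIsBlock v in block
    ... | false = count-none _ (upTo n) λ {x} _ → trans (tailIsBlock-∷ x v) (trans (cong (not (x % suc e ∈ᵇ (0 ∷ map (_% suc e) v)) ∧_) block) (∧-zeroʳ _))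
    ... | true  = begin
      count (λ x → tailIsBlock (x ∷ v)) (upTo n)
        ≡⟨ count-cong _ _ (upTo n) (λ {x} _ → trans (tailIsBlock-∷ x v) (trans (cong (not (x % suc e ∈ᵇ L) ∧_) block) (∧-identityʳ _))) ⟩
      count (λ x → not (x % suc e ∈ᵇ L)) (upTo (m * suc e))  ≡⟨ count-residues (suc e) (λ r → not (r ∈ᵇ L)) m ⟩
      m * count (λ r → not (r ∈ᵇ L)) (upTo (suc e))         ≡⟨ cong (m *_) (count-∉ᵇ (suc e) block L<g) ⟩
      m * (suc e ∸ length L)                                ≡⟨ cong (λ l → m * (suc e ∸ suc l)) (trans (length-map _ v) (proj₁ (∈-tuples⁻ {k = k} v∈))) ⟩
      m * (e ∸ k)                                           ∎
      where
      L = 0 ∷ map (_% suc e) v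
      L<g : All (_< suc e) L
      L<g = z<s ∷ All-map⁺ (All.tabulate (λ {x} _ → m%n<n x (suc e)))

  count-blocks : count isBlock (tuples n (suc e)) ≡ m ^ e * e !
  count-blocks = trans count-isBlock (trans (count-tailIsBlock e ≤-refl) (cong (m ^ e *_) (P′-! e)))

-- Totients

length-filter : {P : A → Set} (P? : U.Decidable P) (xs : List A) → length (filter P? xs) ≡ count (λ x → ⌊ P? x ⌋) xs
length-filter P? []       = refl
length-filter P? (x ∷ xs) with P? x
... | yes _ = cong suc (length-filter P? xs)
... | no _  = length-filter P? xs

gcd-diagonal : ∀ m → gcd m m ≡ m
gcd-diagonal m = ∣-antisym (gcd[m,n]∣m m m) (gcd-greatest ∣-refl ∣-refl)

φ-upTo : ∀ m → count (λ k → ⌊ gcd k m ≟ 1 ⌋) (upTo m) ≡ φ m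
φ-upTo zero       = refl
φ-upTo m@(suc m′) = begin
  count coprime (0 ∷ rest)                    ≡⟨ count-++ coprime [ 0 ] rest ⟩
  count coprime [ 0 ] + count coprime rest    ≡⟨ cong (λ k → count (λ _ → ⌊ k ≟ 1 ⌋) [ 0 ] + count coprime rest) gcd-0≡gcd-m ⟩
  count coprime [ m ] + count coprime rest    ≡⟨ +-comm (count coprime [ m ]) _ ⟩
  count coprime rest + count coprime [ m ]    ≡⟨ count-++ coprime rest [ m ] ⟨
  count coprime (rest ++ [ m ])               ≡⟨ cong (count coprime) (applyUpTo-∷ʳ suc m′) ⟩
  count coprime (applyUpTo suc m)          ≡⟨ length-filter (λ k → gcd k m ≟ 1) (applyUpTo suc m) ⟨
  φ m                                      ∎
  where
  open ≡-Reasoning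
  rest = applyUpTo suc m′
  coprime : ℕ → Bool
  coprime k = ⌊ gcd k m ≟ 1 ⌋
  gcd-0≡gcd-m : gcd 0 m ≡ gcd m m
  gcd-0≡gcd-m = trans (gcd-identityˡ m) (sym (gcd-diagonal m))

gcd-fibre : ∀ m d .{{_ : NonZero d}} → count (λ u → ⌊ gcd u (m * d) ≟ d ⌋) (upTo (m * d)) ≡ φ m
gcd-fibre m d = trans (count-bijection _≟_ _≟_ _ _ (_/ d) (_* d) (Unique.upTo⁺ (m * d)) (Unique.upTo⁺ m)
    divide-into multiply-into divide-inverse (λ _ _ → m*n/n≡m _ d))
  (φ-upTo m)
  where
  gcd-* : ∀ a b → gcd (a * d) (b * d) ≡ d * gcd a b
  gcd-* a b = trans (cong₂ gcd (*-comm a d) (*-comm b d)) (sym (c*gcd[m,n]≡gcd[cm,cn] d a b))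
  d∣ : ∀ {u} → ⌊ gcd u (m * d) ≟ d ⌋ ≡ true → d ∣ u
  d∣ {u} eq = subst (_∣ u) (⌊⌋-true⁻¹ (gcd u (m * d) ≟ d) eq) (gcd[m,n]∣m u (m * d))
  divide-inverse : LeftInverseOn (λ u → ⌊ gcd u (m * d) ≟ d ⌋) (upTo (m * d)) (_/ d) (_* d)
  divide-inverse _ eq = m/n*n≡m (d∣ eq)
  divide-into : MapsInto (λ u → ⌊ gcd u (m * d) ≟ d ⌋) (upTo (m * d)) (λ k → ⌊ gcd k m ≟ 1 ⌋) (upTo m) (_/ d)
  divide-into {u} u∈ eq = ∈-upTo⁺ (m<n*o⇒m/o<n (∈-upTo⁻ u∈)) , ⌊⌋-true (gcd (u / d) m ≟ 1)
    (*-cancelˡ-≡ _ 1 d (begin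
      d * gcd (u / d) m         ≡⟨ gcd-* (u / d) m ⟨
      gcd (u / d * d) (m * d)   ≡⟨ cong (λ v → gcd v (m * d)) (m/n*n≡m (d∣ eq)) ⟩
      gcd u (m * d)             ≡⟨ ⌊⌋-true⁻¹ (gcd u (m * d) ≟ d) eq ⟩
      d                         ≡⟨ *-identityʳ d ⟨
      d * 1                     ∎))
    where open ≡-Reasoning
  multiply-into : MapsInto (λ k → ⌊ gcd k m ≟ 1 ⌋) (upTo m) (λ u → ⌊ gcd u (m * d) ≟ d ⌋) (upTo (m * d)) (_* d)
  multiply-into {k} k∈ eq = ∈-upTo⁺ (*-monoˡ-< d (∈-upTo⁻ k∈)) , ⌊⌋-true (gcd (k * d) (m * d) ≟ d)
    (trans (gcd-* k m) (trans (cong (d *_) (⌊⌋-true⁻¹ (gcd k m ≟ 1) eq)) (*-identityʳ d)))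

divisors-unique : ∀ n → Unique (divisors n)
divisors-unique n = Unique.filter⁺ _ (Unique.applyUpTo⁺₁ suc n (λ i<j _ → <⇒≢ i<j ∘ suc-injective))

gcd∈divisors : ∀ c n .{{_ : NonZero n}} → gcd c n ∈ divisors n
gcd∈divisors c n with gcd c n | gcd[m,n]∣n c n | gcd[m,n]≢0 c n (inj₂ (≢-nonZero⁻¹ n))
... | zero  | _   | gcd≢0 = contradiction refl gcd≢0
... | suc _ | d∣n | _     = ∈-filter⁺ _ (∈-applyUpTo⁺ suc (∣⇒≤ d∣n)) d∣n

fibre*fixedCount≡term : ∀ n .{{_ : NonZero n}} m e → n ≡ m * suc e →
  fibreSize (λ c → gcd c n) (upTo n) (suc e) * Shift.fixedCount n (suc e) ≡ term n (suc e)
fibre*fixedCount≡term n zero       e n≡0 = contradiction n≡0 (≢-nonZero⁻¹ n)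
fibre*fixedCount≡term _ m@(suc _) e refl = begin
  count (λ c → ⌊ gcd c n ≟ suc e ⌋) (upTo n) * fixedCount (suc e)
    ≡⟨ cong₂ _*_ (gcd-fibre m (suc e)) fixedCount≡count-admissible ⟩
  φ m * count admissible blockPairs                                  ≡⟨ cong (φ m *_) count-admissible ⟩
  φ m * (count (λ u → ⌊ gcd u n ≟ suc e ⌋) (upTo n) * count isBlock (tuples n (suc e)))
    ≡⟨ cong (φ m *_) (cong₂ _*_ (gcd-fibre m (suc e)) count-blocks) ⟩
  φ m * (φ m * (m ^ e * e !))                                        ≡⟨ reorder (φ m) (m ^ e) (e !) ⟩
  φ m ^ 2 * m ^ e * e !                                              ≡⟨ cong (λ q → φ q ^ 2 * q ^ e * e !) (m*n/n≡m m (suc e)) ⟨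
  term (m * suc e) (suc e)                                           ∎
  where
  open ≡-Reasoning
  open ShiftByDivisor m (suc e)
  open Shift n using (fixedCount)
  open Blocks m e using (count-blocks)
  reorder : ∀ f p q → f * (f * (p * q)) ≡ f * (f * 1) * p * q
  reorder = solve-∀

divisor-contribution : ∀ n .{{_ : NonZero n}} {d} → d ∈ divisors n →
  fibreSize (λ c → gcd c n) (upTo n) d * Shift.fixedCount n d ≡ term n d
divisor-contribution n d∈
  with d∈range , divides m n≡md ← ∈-filter⁻ (_∣? n) {xs = applyUpTo suc n} d∈
  with e , _ , refl ← ∈-applyUpTo⁻ suc d∈range = fibre*fixedCount≡term n m e n≡md

theorem2 : (n : ℕ) → n ≥ 1 → n ∣ S n
theorem2 n@(suc _) _ = subst (n ∣_) fixedCounts≡S n∣fixedCounts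
  where
  open Shift n
  open ≡-Reasoning
  fixedCounts≡S : sum (map fixedCount (upTo n)) ≡ S n
  fixedCounts≡S = begin
    sum (map fixedCount (upTo n))
      ≡⟨ cong sum (map-cong fixedCount-gcd (upTo n)) ⟩
    sum (map (λ c → fixedCount (gcd c n)) (upTo n))
      ≡⟨ sum-by-fibres fixedCount (λ c → gcd c n) (upTo n) (divisors-unique n) (λ {c} _ → gcd∈divisors c n) ⟩
    sum (map (λ d → fibreSize (λ c → gcd c n) (upTo n) d * fixedCount d) (divisors n))
      ≡⟨ cong sum (map-cong-local (All.tabulate (divisor-contribution n))) ⟩
    sum (map (term n) (divisors n))
      ∎
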